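{- If a nearly ordered permutation group $(N,G)$ is highly interval-transitive, then $(\bar N,G)$ is highly approximately $o$-transitive.
   Context: Let $L$ be a dense linear order. A nearly ordered permutation group $(N,G)$, $G\le\mathrm{Aut}(N)$, is of one of four types: linear ($N=(L,<)$, $L$ without endpoints, order-preserving bijections), monotonic ($N=\mathrm{ED}(L)$, $L$ without endpoints, automorphisms = order-preserving or order-reversing bijections), circular ($N=(L,\mathrm{Cr})$ with $L$ having at most one endpoint, $\mathrm{Cr}(x,y,z)$ iff $x<y<z$ or $y<z<x$ or $z<x<y$, automorphisms = $\mathrm{Cr}$-preserving bijections), monocircular ($N=\mathrm{EO}(L)$, automorphisms = bijections preserving or reversing $\mathrm{Cr}$). $\bar N$ is the Dedekind completion of the same type ($\bar L$ without added endpoints in the linear/monotonic cases; $\bar L$ with one endpoint adjoined if it has none, circularized, in the circular cases); elements of $G$ extend uniquely to $\bar N$. Bounded intervals: $(x,y)$, $x<y$ (linear/monotonic); $(x,y)=\{z:\mathrm{Cr}(x,z,y)\}$, $x\ne y$ (circular); intervals also include rays and $L$ (linear/monotonic), and the whole circle and circle minus a point (circular). In the circular cases, $\mathrm{Cr}(x_1,\ldots,x_n)$ means $\mathrm{Cr}(x_i,x_j,x_k)$ for all $i<j<k$ ($\mathrm{Cr}(x_1,x_2)$ means $x_1\ne x_2$, $\mathrm{Cr}(x_1)$ is always true), and $\mathrm{Crs}(I_1,\ldots,I_n)$ means each $I_k\ne\emptyset$ and $\mathrm{Cr}(x_1,\ldots,x_n)$ whenever $x_k\in I_k$ ($\mathrm{Crs}(I_1,I_2)$: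 disjoint). $n$-interval-transitive: for all $N$-intervals $I_1<\dots<I_n$ and $J_1<\dots<J_n$ (linear/monotonic; order of $L$), resp. with $\mathrm{Crs}(I_1,\ldots,I_n)$ and $\mathrm{Crs}(J_1,\ldots,J_n)$ (circular), some $g\in G$ has $g(I_k)\cap J_k\ne\emptyset$ for all $k$. Approximately $n$-$o$-transitive on $\bar N$: for all $a_1<\dots<a_n$ in $\bar N$ and $\bar N$-intervals $J_1<\dots<J_n$ (resp. $\mathrm{Cr}(a_1,\ldots,a_n)$ and $\mathrm{Crs}(J_1,\ldots,J_n)$), some $g\in G$ has $g(a_k)\in J_k$ for all $k$. "Highly" means for every $n$. -}

module Defs where

open import Level using (Level; _⊔_; 0ℓ; Lift; lift) renaming (suc to lsuc)
open import Data.Nat using (ℕ)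
open import Data.Fin using (Fin) renaming (_<_ to _<ᶠ_)
open import Data.Product using (Σ; ∃; ∃₂; _×_; _,_)
open import Data.Sum using (_⊎_)
open import Data.Unit.Polymorphic using (⊤)
open import Relation.Nullary using (¬_)
open import Relation.Binary.Core using (Rel)
open import Relation.Binary.Structures using (IsStrictTotalOrder)
open import Relation.Binary.PropositionalEquality using (_≡_)
open import Function.Bundles using (_↔_; Inverse)
open import Function.Construct.Identity using (↔-id)
open import Function.Construct.Composition using (_↔-∘_)
open import Function.Construct.Symmetry using (↔-sym)

record DenseLinearOrder : Set₁ where
  field
    Carrier            : Set
    _<_                : Rel Carrier 0ℓ
    isStrictTotalOrder : IsStrictTotalOrder _≡_ _<_
    dense              : ∀ {x y} → x < y → ∃ λ z → x < z × z < y
    nontrivial         : ∃₂ λ x y → x < y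

data Kind : Set where
  linear monotonic circular monocircular : Kind

data Shape : Set where
  lin circ : Shape

shape : Kind → Shape
shape linear       = lin
shape monotonic    = lin
shape circular     = circ
shape monocircular = circ

module Generic {a b c : Level} {P : Set a}
               (_≈_ : P → P → Set c) (_<_ : P → P → Set b) where

  Cr : P → P → P → Set b
  Cr x y z = (x < y × y < z) ⊎ (y < z × z < x) ⊎ (z < x × x < y)

  -- Cr(x₁,…,xₙ): Cr(xᵢ,xⱼ,xₖ) for all i<j<k, and the xᵢ pairwise
  -- distinct (the latter is implied for n ≥ 3 and is the meaning for n = 2)
  CrN : ∀ {n} → (Fin n → P) → Set (b ⊔ c)
  CrN {n} xs =
    (∀ (i j k : Fin n) → i <ᶠ j → j <ᶠ k → Cr (xs i) (xs j) (xs k)) ×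
    (∀ (i j : Fin n) → i <ᶠ j → ¬ (xs i ≈ xs j))

  data LinInterval : Set (a ⊔ b) where
    bounded : (x y : P) → x < y → LinInterval
    above   : P → LinInterval
    below   : P → LinInterval
    univ    : LinInterval

  ⟦_⟧ˡ : LinInterval → P → Set b
  ⟦ bounded x y _ ⟧ˡ z = x < z × z < y
  ⟦ above x ⟧ˡ       z = x < z
  ⟦ below x ⟧ˡ       z = z < x
  ⟦ univ ⟧ˡ          z = ⊤

  data CircInterval : Set (a ⊔ c) where
    arc   : (x y : P) → ¬ (x ≈ y) → CircInterval
    whole : CircInterval
    punct : P → CircInterval

  ⟦_⟧ᶜ : CircInterval → P → Set (b ⊔ c)
  ⟦ arc x y _ ⟧ᶜ z = Lift c (Cr x z y)
  ⟦ whole ⟧ᶜ     z = ⊤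
  ⟦ punct x ⟧ᶜ   z = Lift b (¬ (z ≈ x))

  Interval : Shape → Set (a ⊔ b ⊔ c)
  Interval lin  = Lift c LinInterval
  Interval circ = Lift b CircInterval

  ⟦_⟧ : ∀ {s} → Interval s → P → Set (b ⊔ c)
  ⟦_⟧ {lin}  (lift I) z = Lift c (⟦ I ⟧ˡ z)
  ⟦_⟧ {circ} (lift I) z = ⟦ I ⟧ᶜ z

  OrderedSets : ∀ {n ℓ} → Shape → (Fin n → P → Set ℓ) → Set (a ⊔ b ⊔ c ⊔ ℓ)
  OrderedSets {n} lin S = Lift c (
    ∀ (i j : Fin n) → i <ᶠ j → ∀ x y → S i x → S j y → x < y)
  OrderedSets {n} circ S =
    (∀ (i : Fin n) → ∃ λ x → S i x) ×
    (∀ (xs : Fin n → P) → (∀ i → S i (xs i)) → CrN xs)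

  OrderedPoints : ∀ {n} → Shape → (Fin n → P) → Set (b ⊔ c)
  OrderedPoints {n} lin  xs = Lift c (∀ (i j : Fin n) → i <ᶠ j → xs i < xs j)
  OrderedPoints {n} circ xs = CrN xs

  PresOrd RevOrd PresCr RevCr : (P → P) → Set (a ⊔ b)
  PresOrd f = ∀ x y → (x < y → f x < f y) × (f x < f y → x < y)
  RevOrd  f = ∀ x y → (x < y → f y < f x) × (f y < f x → x < y)
  PresCr  f = ∀ x y z → (Cr x y z → Cr (f x) (f y) (f z)) × (Cr (f x) (f y) (f z) → Cr x y z)
  RevCr   f = ∀ x y z → (Cr x y z → Cr (f z) (f y) (f x)) × (Cr (f z) (f y) (f x) → Cr x y z)

  Sense : Kind → (P → P) → Set (a ⊔ b)
  Sense linear       f = PresOrd f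
  Sense monotonic    f = PresOrd f ⊎ RevOrd f
  Sense circular     f = PresCr f
  Sense monocircular f = PresCr f ⊎ RevCr f

module _ (𝕃 : DenseLinearOrder) where
  open DenseLinearOrder 𝕃 renaming (Carrier to L)

  private module GL = Generic {P = L} _≡_ _<_

  HasMin HasMax : Set
  HasMin = ∃ λ m → ∀ x → ¬ (x < m)
  HasMax = ∃ λ m → ∀ x → ¬ (m < x)

  EndpointCondition : Kind → Set
  EndpointCondition k with shape k
  ... | lin  = ¬ HasMin × ¬ HasMax
  ... | circ = ¬ (HasMin × HasMax)

  IsAut : Kind → L ↔ L → Set
  IsAut k g = GL.Sense k (Inverse.to g)

  record IsNearlyOrderedPermGroup (k : Kind) (G : L ↔ L → Set) : Set where
    field
      ⊆Aut   : ∀ g → G g → IsAut k g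
      has-id : G (↔-id L)
      ∘-closed : ∀ g h → G g → G h → G (g ↔-∘ h)
      ⁻¹-closed : ∀ g → G g → G (↔-sym g)

  -- The Dedekind completion N̄, realised as lower cuts:
  -- downward closed subsets without greatest element, not all of L.
  -- Linear/monotonic: cuts are nonempty (Dedekind completion without
  -- added endpoints).  Circular: the empty cut is allowed unless L has
  -- a greatest element; this adjoins one endpoint exactly when L̄ has none.

  LowerCond : Kind → (L → Set) → Set
  LowerCond k D with shape k
  ... | lin  = ∃ λ x → D x
  ... | circ = (∃ λ x → D x) ⊎ ¬ HasMax

  record IsCut (k : Kind) (D : L → Set) : Set where
    field
      downClosed : ∀ x y → y < x → D x → D y
      noMax      : ∀ x → D x → ∃ λ y → x < y × D y
      notAll     : ∃ λ x → ¬ D x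
      lowerCond  : LowerCond k D

  record Cut (k : Kind) : Set₁ where
    constructor cut
    field
      pred  : L → Set
      isCut : IsCut k pred
  open Cut public

  _≈̄_ : ∀ {k} → Cut k → Cut k → Set
  D ≈̄ E = ∀ x → (pred D x → pred E x) × (pred E x → pred D x)

  _<̄_ : ∀ {k} → Cut k → Cut k → Set
  D <̄ E = (∀ x → pred D x → pred E x) × ∃ λ x → pred E x × ¬ pred D x

  Represents : ∀ {k} → Cut k → L → Set
  Represents c l = ∀ x → (pred c x → x < l) × (x < l → pred c x)

  module GB (k : Kind) = Generic {P = Cut k} _≈̄_ _<̄_

  record BarAut (k : Kind) : Set₁ where
    field
      fun inv   : Cut k → Cut k
      fun-cong  : ∀ {a b} → a ≈̄ b → fun a ≈̄ fun b
      inv-cong  : ∀ {a b} → a ≈̄ b → inv a ≈̄ inv b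
      inverseˡ  : ∀ a → fun (inv a) ≈̄ a
      inverseʳ  : ∀ a → inv (fun a) ≈̄ a
      sense     : GB.Sense k k fun
  open BarAut public

  Extends : ∀ {k} → L ↔ L → BarAut k → Set₁
  Extends g ḡ = ∀ c l → Represents c l → Represents (fun ḡ c) (Inverse.to g l)

  IntervalTransitive : Kind → (L ↔ L → Set) → ℕ → Set
  IntervalTransitive k G n =
    ∀ (I J : Fin n → GL.Interval (shape k)) →
    GL.OrderedSets (shape k) (λ i → GL.⟦ I i ⟧) →
    GL.OrderedSets (shape k) (λ i → GL.⟦ J i ⟧) →
    ∃ λ g → G g × (∀ i → ∃ λ x → GL.⟦ I i ⟧ x × GL.⟦ J i ⟧ (Inverse.to g x))

  HighlyIntervalTransitive : Kind → (L ↔ L → Set) → Set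
  HighlyIntervalTransitive k G = ∀ n → IntervalTransitive k G n

  ApproxOTransitiveBar : Kind → (L ↔ L → Set) → ℕ → Set₁
  ApproxOTransitiveBar k G n =
    ∀ (a : Fin n → Cut k) (J : Fin n → GB.Interval k (shape k)) →
    GB.OrderedPoints k (shape k) a →
    GB.OrderedSets k (shape k) (λ i → GB.⟦_⟧ k (J i)) →
    ∃ λ g → G g × Σ (BarAut k) λ ḡ → Extends g ḡ ×
      (∀ i → GB.⟦_⟧ k (J i) (fun ḡ (a i)))

  HighlyApproxOTransitiveBar : Kind → (L ↔ L → Set) → Set₁
  HighlyApproxOTransitiveBar k G = ∀ n → ApproxOTransitiveBar k G n

module Submission where

-- Around each point aᵢ of N̄ choose three small intervals of L: one just below aᵢ (inside the
-- cut) and two just above it; inside each target interval Jᵢ choose a window cut into three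
-- consecutive steps.  Interval transitivity for these 3n sources and 3n steps gives g ∈ G sending
-- a point below aᵢ and a point above aᵢ into the first two steps of the i-th window, so the
-- extension ḡ of g to N̄ sends aᵢ into Jᵢ.  Three points per aᵢ suffice to see that g does not
-- reverse the (circular) order.  In the circular case the points are first reindexed so that the
-- least one comes first; the sources next to the ends of L then wrap around, and ḡ is the image
-- of a cut in the order obtained by cutting the circle where g crosses the end of L.

open import Defs
open import Level using (Level; lift; lower; 0ℓ)
open import Axiom.ExcludedMiddle using (ExcludedMiddle)
open import Axiom.DoubleNegationElimination using (em⇒dne)
open import Function.Bundles using (_↔_; Inverse)
open import Function.Base using (id)
open import Function.Construct.Identity using (↔-id)
open import Data.Nat as ℕ using (ℕ; zero; suc; z≤n; s≤s)
import Data.Nat.Properties as ℕP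
open import Data.Fin as F using (Fin; toℕ)
open import Data.Fin.Patterns using (0F; 1F; 2F)
import Data.Fin.Properties as FP
open import Data.Product using (Σ; ∃; ∃₂; _×_; _,_; proj₁; proj₂)
open import Data.Product.Relation.Binary.Lex.Strict using (×-Lex)
open import Data.Sum using (_⊎_; inj₁; inj₂)
open import Data.Empty using (⊥; ⊥-elim)
open import Data.Unit using (tt) renaming (⊤ to ⊤₀)
open import Relation.Nullary using (¬_; Dec; yes; no)
open import Relation.Binary.Core using (Rel)
open import Relation.Binary.Definitions using (Tri; tri<; tri≈; tri>)
open import Relation.Binary.Structures using (IsStrictTotalOrder)
open import Relation.Binary.PropositionalEquality
  using (_≡_; _≢_; refl; sym; trans; cong; subst; subst₂)

_<ₗₑₓ_ : ∀ {n k} → Rel (Fin n × Fin k) 0ℓ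
_<ₗₑₓ_ = ×-Lex _≡_ F._<_ F._<_

combine-<ₗₑₓ : ∀ {n k} (i j : Fin n) (s t : Fin k) →
               F.combine i s F.< F.combine j t → (i , s) <ₗₑₓ (j , t)
combine-<ₗₑₓ {k = k} i j s t lt with FP.<-cmp i j
... | tri< i<j _ _ = inj₁ i<j
... | tri> _ _ j<i = ⊥-elim (FP.<-asym lt (FP.combine-monoˡ-< t s j<i))
... | tri≈ _ refl _ = inj₂ (refl , ℕP.+-cancelˡ-< (k ℕ.* toℕ i) (toℕ s) (toℕ t)
        (subst₂ ℕ._<_ (FP.toℕ-combine i s) (FP.toℕ-combine i t) lt))

remQuot-<ₗₑₓ : ∀ {n} k {p q : Fin (n ℕ.* k)} → p F.< q → F.remQuot k p <ₗₑₓ F.remQuot k q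
remQuot-<ₗₑₓ {n} k {p} {q} lt =
  combine-<ₗₑₓ {n} {k} _ _ _ _ (subst₂ F._<_ (sym (FP.combine-remQuot {n} k p)) (sym (FP.combine-remQuot {n} k q)) lt)

module Cyclic {a b} {X : Set a} (_<_ : Rel X b) where
  open Generic {P = X} _≡_ _<_ using (Cr) public

  Cr-rotate : ∀ {x y z} → Cr x y z → Cr y z x
  Cr-rotate (inj₁ p)        = inj₂ (inj₂ p)
  Cr-rotate (inj₂ (inj₁ p)) = inj₁ p
  Cr-rotate (inj₂ (inj₂ p)) = inj₂ (inj₁ p)

  Cr-rotate⁻¹ : ∀ {x y z} → Cr x y z → Cr z x y
  Cr-rotate⁻¹ c = Cr-rotate (Cr-rotate c)

  Cr-asym : (∀ {x y} → x < y → ¬ y < x) → ∀ {x y z} → Cr x y z → ¬ Cr z y x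
  Cr-asym as (inj₁ (p , q))        (inj₁ (p′ , q′))        = as q p′
  Cr-asym as (inj₁ (p , q))        (inj₂ (inj₁ (p′ , q′))) = as p p′
  Cr-asym as (inj₁ (p , q))        (inj₂ (inj₂ (p′ , q′))) = as q q′
  Cr-asym as (inj₂ (inj₁ (p , q))) (inj₁ (p′ , q′))        = as p p′
  Cr-asym as (inj₂ (inj₁ (p , q))) (inj₂ (inj₁ (p′ , q′))) = as q q′
  Cr-asym as (inj₂ (inj₁ (p , q))) (inj₂ (inj₂ (p′ , q′))) = as p q′
  Cr-asym as (inj₂ (inj₂ (p , q))) (inj₁ (p′ , q′))        = as q q′
  Cr-asym as (inj₂ (inj₂ (p , q))) (inj₂ (inj₁ (p′ , q′))) = as q p′
  Cr-asym as (inj₂ (inj₂ (p , q))) (inj₂ (inj₂ (p′ , q′))) = as p p′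

module _ {a a′ b c} {X : Set a} {Y : Set a′} {_<_ : Rel X b} {_<′_ : Rel Y c} (h : X → Y) where
  private
    module C = Cyclic _<_
    module C′ = Cyclic _<′_

  Cr-map : (∀ {u v} → u < v → h u <′ h v) → ∀ {x y z} → C.Cr x y z → C′.Cr (h x) (h y) (h z)
  Cr-map f (inj₁ (p , q))        = inj₁ (f p , f q)
  Cr-map f (inj₂ (inj₁ (p , q))) = inj₂ (inj₁ (f p , f q))
  Cr-map f (inj₂ (inj₂ (p , q))) = inj₂ (inj₂ (f p , f q))

  Cr-reflect : (∀ {u v} → h u <′ h v → u < v) → ∀ {x y z} → C′.Cr (h x) (h y) (h z) → C.Cr x y z
  Cr-reflect f (inj₁ (p , q))        = inj₁ (f p , f q)
  Cr-reflect f (inj₂ (inj₁ (p , q))) = inj₂ (inj₁ (f p , f q))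
  Cr-reflect f (inj₂ (inj₂ (p , q))) = inj₂ (inj₂ (f p , f q))

module MoveToFront {a b} {X : Set a} (_<_ : Rel X b) (A : X → Set b) (A? : ∀ x → Dec (A x))
  (<-asym : ∀ {x y} → x < y → ¬ y < x) (below-A : ∀ {x y} → ¬ A x → A y → x < y) where

  _<ᴬ_ : Rel X b
  x <ᴬ y = (A x × A y × x < y) ⊎ (¬ A x × ¬ A y × x < y) ⊎ (A x × ¬ A y)

  private
    module C = Cyclic _<_
    module Cᴬ = Cyclic _<ᴬ_

    <ᴬ⇒< : ∀ {x y} → (A x → A y) → (A y → A x) → x <ᴬ y → x < y
    <ᴬ⇒< _ _ (inj₁ (_ , _ , p))        = p
    <ᴬ⇒< _ _ (inj₂ (inj₁ (_ , _ , p))) = p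
    <ᴬ⇒< f _ (inj₂ (inj₂ (ax , nay)))  = ⊥-elim (nay (f ax))

    inside : ∀ {x y} → A x → A y → x < y → x <ᴬ y
    inside ax ay p = inj₁ (ax , ay , p)

    outside : ∀ {x y} → ¬ A x → ¬ A y → x < y → x <ᴬ y
    outside nax nay p = inj₂ (inj₁ (nax , nay , p))

    across : ∀ {x y} → A x → ¬ A y → x <ᴬ y
    across ax nay = inj₂ (inj₂ (ax , nay))

    not-across : ∀ {x y} → ¬ A x → A y → ¬ x <ᴬ y
    not-across nax ay (inj₁ (ax , _ , _))        = nax ax
    not-across nax ay (inj₂ (inj₁ (_ , nay , _))) = nay ay
    not-across nax ay (inj₂ (inj₂ (ax , _)))      = nax ax

    inside⁻¹ : ∀ {x y} → A x → A y → x <ᴬ y → x < y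
    inside⁻¹ ax ay = <ᴬ⇒< (λ _ → ay) (λ _ → ax)

    outside⁻¹ : ∀ {x y} → ¬ A x → ¬ A y → x <ᴬ y → x < y
    outside⁻¹ nax nay = <ᴬ⇒< (λ a → ⊥-elim (nax a)) (λ a → ⊥-elim (nay a))

    AAA⇒ : ∀ {x y z} → A x → A y → A z → C.Cr x y z → Cᴬ.Cr x y z
    AAA⇒ ax ay az (inj₁ (p , q))        = inj₁ (inside ax ay p , inside ay az q)
    AAA⇒ ax ay az (inj₂ (inj₁ (p , q))) = inj₂ (inj₁ (inside ay az p , inside az ax q))
    AAA⇒ ax ay az (inj₂ (inj₂ (p , q))) = inj₂ (inj₂ (inside az ax p , inside ax ay q))

    AAA⇐ : ∀ {x y z} → A x → A y → A z → Cᴬ.Cr x y z → C.Cr x y z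
    AAA⇐ ax ay az (inj₁ (p , q))        = inj₁ (inside⁻¹ ax ay p , inside⁻¹ ay az q)
    AAA⇐ ax ay az (inj₂ (inj₁ (p , q))) = inj₂ (inj₁ (inside⁻¹ ay az p , inside⁻¹ az ax q))
    AAA⇐ ax ay az (inj₂ (inj₂ (p , q))) = inj₂ (inj₂ (inside⁻¹ az ax p , inside⁻¹ ax ay q))

    BBB⇒ : ∀ {x y z} → ¬ A x → ¬ A y → ¬ A z → C.Cr x y z → Cᴬ.Cr x y z
    BBB⇒ ax ay az (inj₁ (p , q))        = inj₁ (outside ax ay p , outside ay az q)
    BBB⇒ ax ay az (inj₂ (inj₁ (p , q))) = inj₂ (inj₁ (outside ay az p , outside az ax q))
    BBB⇒ ax ay az (inj₂ (inj₂ (p , q))) = inj₂ (inj₂ (outside az ax p , outside ax ay q))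

    BBB⇐ : ∀ {x y z} → ¬ A x → ¬ A y → ¬ A z → Cᴬ.Cr x y z → C.Cr x y z
    BBB⇐ ax ay az (inj₁ (p , q))        = inj₁ (outside⁻¹ ax ay p , outside⁻¹ ay az q)
    BBB⇐ ax ay az (inj₂ (inj₁ (p , q))) = inj₂ (inj₁ (outside⁻¹ ay az p , outside⁻¹ az ax q))
    BBB⇐ ax ay az (inj₂ (inj₂ (p , q))) = inj₂ (inj₂ (outside⁻¹ az ax p , outside⁻¹ ax ay q))

    AAB⇒ : ∀ {x y z} → A x → A y → ¬ A z → C.Cr x y z → Cᴬ.Cr x y z
    AAB⇒ ax ay nz (inj₁ (p , q))        = ⊥-elim (<-asym q (below-A nz ay))
    AAB⇒ ax ay nz (inj₂ (inj₁ (p , q))) = ⊥-elim (<-asym p (below-A nz ay))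
    AAB⇒ ax ay nz (inj₂ (inj₂ (p , q))) = inj₁ (inside ax ay q , across ay nz)

    AAB⇐ : ∀ {x y z} → A x → A y → ¬ A z → Cᴬ.Cr x y z → C.Cr x y z
    AAB⇐ ax ay nz (inj₁ (p , q))        = inj₂ (inj₂ (below-A nz ax , inside⁻¹ ax ay p))
    AAB⇐ ax ay nz (inj₂ (inj₁ (p , q))) = ⊥-elim (not-across nz ax q)
    AAB⇐ ax ay nz (inj₂ (inj₂ (p , q))) = ⊥-elim (not-across nz ax p)

    ABB⇒ : ∀ {x y z} → A x → ¬ A y → ¬ A z → C.Cr x y z → Cᴬ.Cr x y z
    ABB⇒ ax ny nz (inj₁ (p , q))        = ⊥-elim (<-asym p (below-A ny ax))
    ABB⇒ ax ny nz (inj₂ (inj₁ (p , q))) = inj₁ (across ax ny , outside ny nz p)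
    ABB⇒ ax ny nz (inj₂ (inj₂ (p , q))) = ⊥-elim (<-asym q (below-A ny ax))

    ABB⇐ : ∀ {x y z} → A x → ¬ A y → ¬ A z → Cᴬ.Cr x y z → C.Cr x y z
    ABB⇐ ax ny nz (inj₁ (p , q))        = inj₂ (inj₁ (outside⁻¹ ny nz q , below-A nz ax))
    ABB⇐ ax ny nz (inj₂ (inj₁ (p , q))) = ⊥-elim (not-across nz ax q)
    ABB⇐ ax ny nz (inj₂ (inj₂ (p , q))) = ⊥-elim (not-across nz ax p)

  Cr⇒Crᴬ : ∀ x y z → C.Cr x y z → Cᴬ.Cr x y z
  Cr⇒Crᴬ x y z c with A? x | A? y | A? z
  ... | yes ax | yes ay | yes az = AAA⇒ ax ay az c
  ... | no ax  | no ay  | no az  = BBB⇒ ax ay az c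
  ... | yes ax | yes ay | no az  = AAB⇒ ax ay az c
  ... | yes ax | no ay  | yes az = Cᴬ.Cr-rotate (AAB⇒ az ax ay (C.Cr-rotate⁻¹ c))
  ... | no ax  | yes ay | yes az = Cᴬ.Cr-rotate⁻¹ (AAB⇒ ay az ax (C.Cr-rotate c))
  ... | yes ax | no ay  | no az  = ABB⇒ ax ay az c
  ... | no ax  | yes ay | no az  = Cᴬ.Cr-rotate⁻¹ (ABB⇒ ay az ax (C.Cr-rotate c))
  ... | no ax  | no ay  | yes az = Cᴬ.Cr-rotate (ABB⇒ az ax ay (C.Cr-rotate⁻¹ c))

  Crᴬ⇒Cr : ∀ x y z → Cᴬ.Cr x y z → C.Cr x y z
  Crᴬ⇒Cr x y z c with A? x | A? y | A? z
  ... | yes ax | yes ay | yes az = AAA⇐ ax ay az c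
  ... | no ax  | no ay  | no az  = BBB⇐ ax ay az c
  ... | yes ax | yes ay | no az  = AAB⇐ ax ay az c
  ... | yes ax | no ay  | yes az = C.Cr-rotate (AAB⇐ az ax ay (Cᴬ.Cr-rotate⁻¹ c))
  ... | no ax  | yes ay | yes az = C.Cr-rotate⁻¹ (AAB⇐ ay az ax (Cᴬ.Cr-rotate c))
  ... | yes ax | no ay  | no az  = ABB⇐ ax ay az c
  ... | no ax  | yes ay | no az  = C.Cr-rotate⁻¹ (ABB⇐ ay az ax (Cᴬ.Cr-rotate c))
  ... | no ax  | no ay  | yes az = C.Cr-rotate (ABB⇐ az ax ay (Cᴬ.Cr-rotate⁻¹ c))

cycle : ∀ {m} → Fin (suc m) → Fin (suc m)
cycle {m} i with suc (toℕ i) ℕP.<? suc m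
... | yes p = F.fromℕ< p
... | no _  = 0F

toℕ-cycle-< : ∀ {m} (i : Fin (suc m)) → toℕ i ℕ.< m → toℕ (cycle i) ≡ suc (toℕ i)
toℕ-cycle-< {m} i lt with suc (toℕ i) ℕP.<? suc m
... | yes p = FP.toℕ-fromℕ< p
... | no np = ⊥-elim (np (s≤s lt))

toℕ-cycle-last : ∀ {m} (i : Fin (suc m)) → toℕ i ≡ m → toℕ (cycle i) ≡ 0
toℕ-cycle-last {m} i e with suc (toℕ i) ℕP.<? suc m
... | yes p = ⊥-elim (ℕP.<-irrefl e (ℕP.≤-pred p))
... | no _  = refl

<last⊎last : ∀ {m} (i : Fin (suc m)) → toℕ i ℕ.< m ⊎ toℕ i ≡ m
<last⊎last i = ℕP.m≤n⇒m<n∨m≡n (ℕP.≤-pred (FP.toℕ<n i))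

cycle-< : ∀ {m} {i j : Fin (suc m)} → i F.< j → cycle i F.< cycle j ⊎ cycle j F.< cycle i
cycle-< {m} {i} {j} lt with <last⊎last j
... | inj₁ jlo = inj₁ (subst₂ ℕ._<_ (sym (toℕ-cycle-< i (ℕP.<-trans lt jlo))) (sym (toℕ-cycle-< j jlo)) (s≤s lt))
... | inj₂ jhi = inj₂ (subst₂ ℕ._<_ (sym (toℕ-cycle-last j jhi))
                                   (sym (toℕ-cycle-< i (subst (toℕ i ℕ.<_) jhi lt))) (s≤s z≤n))

uncycle : ∀ {m} → Fin (suc m) → Fin (suc m)
uncycle {m} 0F        = F.fromℕ m
uncycle     (F.suc i) = F.inject₁ i

cycle-uncycle : ∀ {m} (i : Fin (suc m)) → cycle (uncycle i) ≡ i
cycle-uncycle {m}     0F        = FP.toℕ-injective (toℕ-cycle-last (F.fromℕ m) (FP.toℕ-fromℕ m))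
cycle-uncycle {suc m} (F.suc i) = FP.toℕ-injective
  (trans (toℕ-cycle-< (F.inject₁ i) (subst (ℕ._< suc m) (sym (FP.toℕ-inject₁ i)) (FP.toℕ<n i)))
         (cong suc (FP.toℕ-inject₁ i)))

uncycle-cycle : ∀ {m} (i : Fin (suc m)) → uncycle (cycle i) ≡ i
uncycle-cycle {m} i with <last⊎last i
... | inj₂ hi = trans (cong uncycle (FP.toℕ-injective {j = 0F} (toℕ-cycle-last i hi)))
                      (FP.toℕ-injective (trans (FP.toℕ-fromℕ m) (sym hi)))
... | inj₁ lo = uncycle-suc (cycle i) (toℕ-cycle-< i lo)
  where
  uncycle-suc : ∀ (j : Fin (suc m)) → toℕ j ≡ suc (toℕ i) → uncycle j ≡ i
  uncycle-suc (F.suc j) e = FP.toℕ-injective (trans (FP.toℕ-inject₁ j) (ℕP.suc-injective e))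

cycle^ : ∀ {m} → ℕ → Fin (suc m) → Fin (suc m)
cycle^ zero    i = i
cycle^ (suc t) i = cycle^ t (cycle i)

cycle^-surjective : ∀ {m} t (i : Fin (suc m)) → ∃ λ r → cycle^ t r ≡ i
cycle^-surjective zero    i = i , refl
cycle^-surjective (suc t) i =
  let (r , e) = cycle^-surjective t i in uncycle r , trans (cong (cycle^ t) (cycle-uncycle r)) e

toℕ-cycle^ : ∀ {m} t (i : Fin (suc m)) → toℕ i ℕ.+ t ℕ.≤ m → toℕ (cycle^ t i) ≡ toℕ i ℕ.+ t
toℕ-cycle^ zero i le = sym (ℕP.+-identityʳ _)
toℕ-cycle^ {m} (suc t) i le =
  let i+1+t≤m = subst (ℕ._≤ m) (ℕP.+-suc (toℕ i) t) le
      e = toℕ-cycle-< i (ℕP.<-≤-trans (s≤s (ℕP.m≤m+n (toℕ i) t)) i+1+t≤m)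
  in trans (toℕ-cycle^ t (cycle i) (subst (λ z → z ℕ.+ t ℕ.≤ m) (sym e) i+1+t≤m))
           (trans (cong (ℕ._+ t) e) (sym (ℕP.+-suc (toℕ i) t)))

module Cycling {a b c} {X : Set a} (_≈_ : X → X → Set c) (_<_ : X → X → Set b)
  (≈-sym : ∀ {x y} → x ≈ y → y ≈ x) where
  open Generic _≈_ _<_ using (CrN; OrderedSets)
  private module C = Cyclic _<_

  CrN-cycle : ∀ {m} (xs : Fin (suc m) → X) → CrN xs → CrN (λ i → xs (cycle i))
  CrN-cycle {m} xs (crs , ds) = cr , d
    where
    cr : ∀ i j k → i F.< j → j F.< k → C.Cr (xs (cycle i)) (xs (cycle j)) (xs (cycle k))
    cr i j k ij jk with <last⊎last k
    ... | inj₁ klo =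
      let jlo = ℕP.<-trans jk klo ; ilo = ℕP.<-trans ij jlo in
      crs (cycle i) (cycle j) (cycle k)
          (subst₂ ℕ._<_ (sym (toℕ-cycle-< i ilo)) (sym (toℕ-cycle-< j jlo)) (s≤s ij))
          (subst₂ ℕ._<_ (sym (toℕ-cycle-< j jlo)) (sym (toℕ-cycle-< k klo)) (s≤s jk))
    ... | inj₂ khi =
      let jlo = subst (toℕ j ℕ.<_) khi jk ; ilo = ℕP.<-trans ij jlo in
      C.Cr-rotate (crs (cycle k) (cycle i) (cycle j)
          (subst₂ ℕ._<_ (sym (toℕ-cycle-last k khi)) (sym (toℕ-cycle-< i ilo)) (s≤s z≤n))
          (subst₂ ℕ._<_ (sym (toℕ-cycle-< i ilo)) (sym (toℕ-cycle-< j jlo)) (s≤s ij)))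
    d : ∀ i j → i F.< j → ¬ (xs (cycle i) ≈ xs (cycle j))
    d i j ij with cycle-< ij
    ... | inj₁ p = ds _ _ p
    ... | inj₂ p = λ e → ds _ _ p (≈-sym e)

  CrN-resp : ∀ {m} {f g : Fin m → X} → (∀ i → f i ≡ g i) → CrN f → CrN g
  CrN-resp {f = f} {g} e (cr , d) =
    (λ i j k ij jk → resp (cr i j k ij jk) (e i) (e j) (e k)) ,
    (λ i j ij → subst₂ (λ u v → ¬ (u ≈ v)) (e i) (e j) (d i j ij))
    where
    resp : ∀ {x y z x′ y′ z′} → C.Cr x y z → x ≡ x′ → y ≡ y′ → z ≡ z′ → C.Cr x′ y′ z′
    resp c refl refl refl = c

  OrderedSets-cycle : ∀ {m ℓ} (S : Fin (suc m) → X → Set ℓ) →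
                      OrderedSets circ S → OrderedSets circ (λ i → S (cycle i))
  OrderedSets-cycle {m} S (nonempty , crn) = (λ i → nonempty (cycle i)) , λ ys h →
    let S-uncycled : ∀ i → S i (ys (uncycle i))
        S-uncycled i = subst (λ j → S j (ys (uncycle i))) (cycle-uncycle i) (h (uncycle i))
    in CrN-resp (λ i → cong ys (uncycle-cycle i)) (CrN-cycle (λ i → ys (uncycle i)) (crn _ S-uncycled))

  CrN-cycle^ : ∀ {m} t (xs : Fin (suc m) → X) → CrN xs → CrN (λ i → xs (cycle^ t i))
  CrN-cycle^ zero    xs c = c
  CrN-cycle^ (suc t) xs c = CrN-cycle (λ i → xs (cycle^ t i)) (CrN-cycle^ t xs c)

  OrderedSets-cycle^ : ∀ {m ℓ} t (S : Fin (suc m) → X → Set ℓ) →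
                       OrderedSets circ S → OrderedSets circ (λ i → S (cycle^ t i))
  OrderedSets-cycle^ zero    S o = o
  OrderedSets-cycle^ (suc t) S o = OrderedSets-cycle (λ i → S (cycle^ t i)) (OrderedSets-cycle^ t S o)

module CircularlyOrdered {a b c ℓ} {X : Set a} (_≈_ : X → X → Set c) (_<_ : X → X → Set b)
  (≈-sym : ∀ {x y} → x ≈ y → y ≈ x)
  {n} (S : Fin n → X → Set ℓ) (S-ordered : Generic.OrderedSets _≈_ _<_ circ S) where
  open Generic _≈_ _<_ using (Cr; CrN)

  private
    Selection : (Fin n → X) → Set ℓ
    Selection xs = ∀ i → S i (xs i)

    default : Fin n → X
    default i = proj₁ (proj₁ S-ordered i)

    update : (Fin n → X) → Fin n → X → Fin n → X
    update xs i x j with j F.≟ i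
    ... | yes _ = x
    ... | no _  = xs j

    update-Selection : ∀ {xs i x} → Selection xs → S i x → Selection (update xs i x)
    update-Selection {i = i} sel sx j with j F.≟ i
    ... | yes refl = sx
    ... | no _     = sel j

    update-≡ : ∀ xs i x → update xs i x i ≡ x
    update-≡ xs i x with i F.≟ i
    ... | yes _ = refl
    ... | no ¬e = ⊥-elim (¬e refl)

    update-≢ : ∀ xs i x {j} → j ≢ i → update xs i x j ≡ xs j
    update-≢ xs i x {j} j≢i with j F.≟ i
    ... | yes e = ⊥-elim (j≢i e)
    ... | no _  = refl

    default-Selection : Selection default
    default-Selection i = proj₂ (proj₁ S-ordered i)

    CrN-Selection : ∀ {xs} → Selection xs → CrN xs
    CrN-Selection = proj₂ S-ordered _

  Cr-selected : ∀ {i j k x y z} → i F.< j → j F.< k → S i x → S j y → S k z → Cr x y z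
  Cr-selected {i} {j} {k} {x} {y} {z} i<j j<k sx sy sz =
    let xs = update (update (update default i x) j y) k z
        sel = update-Selection (update-Selection (update-Selection default-Selection sx) sy) sz
        i≢j = FP.<⇒≢ i<j ; j≢k = FP.<⇒≢ j<k ; i≢k = FP.<⇒≢ (FP.<-trans i<j j<k)
        xs-i = trans (update-≢ _ k z i≢k) (trans (update-≢ _ j y i≢j) (update-≡ default i x))
        xs-j = trans (update-≢ _ k z j≢k) (update-≡ _ j y)
        xs-k = update-≡ _ k z
    in subst₃ (proj₁ (CrN-Selection sel) i j k i<j j<k) xs-i xs-j xs-k
    where
    subst₃ : ∀ {x y z x′ y′ z′} → Cr x y z → x ≡ x′ → y ≡ y′ → z ≡ z′ → Cr x′ y′ z′
    subst₃ c refl refl refl = c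

  ≉-selected : ∀ {i j x y} → i ≢ j → S i x → S j y → ¬ x ≈ y
  ≉-selected {i} {j} {x} {y} i≢j sx sy x≈y = by-cases (FP.<-cmp i j)
    where
    sel = update-Selection (update-Selection default-Selection sx) sy
    xs-i = trans (update-≢ _ j y i≢j) (update-≡ default i x)
    xs-j = update-≡ (update default i x) j y
    by-cases : Tri (i F.< j) (i ≡ j) (j F.< i) → ⊥
    by-cases (tri< i<j _ _) = proj₂ (CrN-Selection sel) i j i<j (subst₂ _≈_ (sym xs-i) (sym xs-j) x≈y)
    by-cases (tri≈ _ e _)   = i≢j e
    by-cases (tri> _ _ j<i) = proj₂ (CrN-Selection sel) j i j<i (subst₂ _≈_ (sym xs-j) (sym xs-i) (≈-sym x≈y))

module Order (lem : ∀ {ℓ : Level} → ExcludedMiddle ℓ) (𝕃 : DenseLinearOrder) where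
  open DenseLinearOrder 𝕃 renaming (Carrier to L) public
  private module STO = IsStrictTotalOrder isStrictTotalOrder
  open STO using (compare) public

  decide : ∀ {ℓ} (P : Set ℓ) → Dec P
  decide P = lem

  ¬¬-elim : ∀ {ℓ} {P : Set ℓ} → ¬ ¬ P → P
  ¬¬-elim = em⇒dne lem

  ¬∀⇒∃¬ : ∀ {a b} {A : Set a} {B : A → Set b} → ¬ (∀ x → B x) → ∃ λ x → ¬ B x
  ¬∀⇒∃¬ h = ¬¬-elim λ k → h λ x → ¬¬-elim λ nb → k (_ , nb)

  <-trans : ∀ {x y z} → x < y → y < z → x < z
  <-trans = STO.trans

  <-irrefl : ∀ {x} → ¬ x < x
  <-irrefl = STO.irrefl refl

  <-asym : ∀ {x y} → x < y → ¬ y < x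
  <-asym p q = <-irrefl (<-trans p q)

  <⇒≢ : ∀ {x y} → x < y → x ≢ y
  <⇒≢ p refl = <-irrefl p

  ≮⇒≥ : ∀ {x y} → ¬ x < y → y < x ⊎ y ≡ x
  ≮⇒≥ {x} {y} x≮y with compare x y
  ... | tri< p _ _ = ⊥-elim (x≮y p)
  ... | tri≈ _ e _ = inj₂ (sym e)
  ... | tri> _ _ p = inj₁ p

  ≮-<-trans : ∀ {x y z} → ¬ y < x → y < z → x < z
  ≮-<-trans y≮x p with ≮⇒≥ y≮x
  ... | inj₁ q    = <-trans q p
  ... | inj₂ refl = p

  dense² : ∀ {x y} → x < y → ∃₂ λ a b → x < a × a < b × b < y
  dense² p with dense p
  ... | a , xa , ay with dense ay
  ... | b , ab , by = a , b , xa , ab , by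

  DownClosed : (L → Set) → Set
  DownClosed D = ∀ x y → y < x → D x → D y

  _⊆_ : (L → Set) → (L → Set) → Set
  D ⊆ E = ∀ x → D x → E x

  ∈∉⇒< : ∀ {D} → DownClosed D → ∀ {x y} → D x → ¬ D y → x < y
  ∈∉⇒< {D} dc {x} {y} dx ndy with compare x y
  ... | tri< p _ _    = p
  ... | tri≈ _ refl _ = ⊥-elim (ndy dx)
  ... | tri> _ _ p    = ⊥-elim (ndy (dc x y p dx))

  ¬HasMin⇒below : ¬ HasMin 𝕃 → ∀ x → ∃ λ y → y < x
  ¬HasMin⇒below noMin x = let (y , h) = ¬∀⇒∃¬ (λ h → noMin (x , h)) in y , ¬¬-elim h

  ¬HasMax⇒above : ¬ HasMax 𝕃 → ∀ x → ∃ λ y → x < y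
  ¬HasMax⇒above noMax x = let (y , h) = ¬∀⇒∃¬ (λ h → noMax (x , h)) in y , ¬¬-elim h

  below⊎¬HasMax : ¬ (HasMin 𝕃 × HasMax 𝕃) → ∀ x → (∃ λ y → y < x) ⊎ ¬ HasMax 𝕃
  below⊎¬HasMax endpoints x with decide (HasMax 𝕃)
  ... | yes hasMax = inj₁ (¬HasMin⇒below (λ hasMin → endpoints (hasMin , hasMax)) x)
  ... | no ¬hasMax = inj₂ ¬hasMax

  ⊈⇒∃ : ∀ {D E} → ¬ (D ⊆ E) → ∃ λ x → D x × ¬ E x
  ⊈⇒∃ n with ¬∀⇒∃¬ n
  ... | x , h = x , ¬¬-elim (λ k → h (λ dx → ⊥-elim (k dx))) , λ ex → h (λ _ → ex)

  ⊆-total : ∀ {D E} → DownClosed D → DownClosed E → D ⊆ E ⊎ E ⊆ D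
  ⊆-total {D} {E} dD dE with decide (D ⊆ E)
  ... | yes p = inj₁ p
  ... | no np with ⊈⇒∃ np
  ... | x , dx , nex = inj₂ λ y ey → dD x y (∈∉⇒< dE ey nex) dx

  record Ladder : Set where
    field
      x₀ x₁ x₂ x₃ : L
      x₀<x₁ : x₀ < x₁
      x₁<x₂ : x₁ < x₂
      x₂<x₃ : x₂ < x₃

    lo hi : Fin 3 → L
    lo 0F                 = x₀
    lo (1F)         = x₁
    lo (2F) = x₂
    hi 0F                 = x₁
    hi (1F)         = x₂
    hi (2F) = x₃

    lo<hi : ∀ t → lo t < hi t
    lo<hi 0F                 = x₀<x₁
    lo<hi (1F)         = x₁<x₂
    lo<hi (2F) = x₂<x₃

    InStep : Fin 3 → L → Set
    InStep t x = lo t < x × x < hi t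

    InStep⇒inside : ∀ t {x} → InStep t x → x₀ < x × x < x₃
    InStep⇒inside 0F                 (p , q) = p , <-trans q (<-trans x₁<x₂ x₂<x₃)
    InStep⇒inside (1F)         (p , q) = <-trans x₀<x₁ p , <-trans q x₂<x₃
    InStep⇒inside (2F) (p , q) = <-trans x₀<x₁ (<-trans x₁<x₂ p) , q

    InStep-< : ∀ {t s x y} → t F.< s → InStep t x → InStep s y → x < y
    InStep-< {0F}         {1F}         _ (_ , q) (p , _) = <-trans q p
    InStep-< {0F}         {2F} _ (_ , q) (p , _) = <-trans q (<-trans x₁<x₂ p)
    InStep-< {1F}   {2F} _ (_ , q) (p , _) = <-trans q p
    InStep-< {1F}   {1F}         (s≤s ())
    InStep-< {2F} {1F}   (s≤s ())
    InStep-< {2F} {2F} (s≤s (s≤s ()))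

  ladder : ∀ {x y} → x < y → Ladder
  ladder {x} {y} x<y = let (a , b , xa , ab , by) = dense² x<y in
    record { x₀ = x ; x₁ = a ; x₂ = b ; x₃ = y ; x₀<x₁ = xa ; x₁<x₂ = ab ; x₂<x₃ = by }

module Cuts (lem : ∀ {ℓ : Level} → ExcludedMiddle ℓ) (𝕃 : DenseLinearOrder) (k : Kind) where
  open Order lem 𝕃 public

  N̄ : Set₁
  N̄ = Cut 𝕃 k

  _<ᶜ_ _≈ᶜ_ : N̄ → N̄ → Set
  _<ᶜ_ = _<̄_ 𝕃
  _≈ᶜ_ = _≈̄_ 𝕃

  cut-downClosed : (D : N̄) → DownClosed (pred D)
  cut-downClosed D = IsCut.downClosed (isCut D)

  cut-noMax : (D : N̄) → ∀ x → pred D x → ∃ λ y → x < y × pred D y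
  cut-noMax D = IsCut.noMax (isCut D)

  cut-notAll : (D : N̄) → ∃ λ x → ¬ pred D x
  cut-notAll D = IsCut.notAll (isCut D)

  ≈ᶜ-refl : ∀ {D} → D ≈ᶜ D
  ≈ᶜ-refl x = (λ d → d) , (λ d → d)

  ≈ᶜ-sym : ∀ {D E} → D ≈ᶜ E → E ≈ᶜ D
  ≈ᶜ-sym e x = proj₂ (e x) , proj₁ (e x)

  <ᶜ-trans : ∀ {D E F} → D <ᶜ E → E <ᶜ F → D <ᶜ F
  <ᶜ-trans (de , x , ex , ndx) (ef , _) = (λ z dz → ef z (de z dz)) , x , ef x ex , ndx

  <ᶜ-irrefl : ∀ {D} → ¬ D <ᶜ D
  <ᶜ-irrefl (_ , x , dx , ndx) = ndx dx

  <ᶜ-asym : ∀ {D E} → D <ᶜ E → ¬ E <ᶜ D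
  <ᶜ-asym {D} {E} p q = <ᶜ-irrefl {D} (<ᶜ-trans {D} {E} {D} p q)

  <ᶜ-respˡ-≈ᶜ : ∀ {D D′ E} → D ≈ᶜ D′ → D <ᶜ E → D′ <ᶜ E
  <ᶜ-respˡ-≈ᶜ e (de , x , ex , ndx) =
    (λ z d′z → de z (proj₂ (e z) d′z)) , x , ex , λ d′x → ndx (proj₂ (e x) d′x)

  <ᶜ-respʳ-≈ᶜ : ∀ {D E E′} → E ≈ᶜ E′ → D <ᶜ E → D <ᶜ E′
  <ᶜ-respʳ-≈ᶜ e (de , x , ex , ndx) = (λ z dz → proj₁ (e z) (de z dz)) , x , proj₁ (e x) ex , ndx

  ≉∧≯⇒<ᶜ : ∀ {D E} → ¬ D ≈ᶜ E → ¬ E <ᶜ D → D <ᶜ E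
  ≉∧≯⇒<ᶜ {D} {E} D≉E E≮D with ⊆-total (cut-downClosed D) (cut-downClosed E)
  ... | inj₁ D⊆E with decide (pred E ⊆ pred D)
  ...   | yes E⊆D = ⊥-elim (D≉E λ x → D⊆E x , E⊆D x)
  ...   | no  E⊈D = D⊆E , ⊈⇒∃ E⊈D
  ≉∧≯⇒<ᶜ {D} {E} D≉E E≮D | inj₂ E⊆D with decide (pred D ⊆ pred E)
  ...   | yes D⊆E = ⊥-elim (D≉E λ x → D⊆E x , E⊆D x)
  ...   | no  D⊈E = ⊥-elim (E≮D (E⊆D , ⊈⇒∃ D⊈E))

  ∉∈⇒<ᶜ : ∀ {C E : N̄} {w} → ¬ pred C w → pred E w → C <ᶜ E
  ∉∈⇒<ᶜ {C} {E} {w} ncw ew = (λ x cx → cut-downClosed E w x (∈∉⇒< (cut-downClosed C) cx ncw) ew) , w , ew , ncw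

  ∈∉⇒<ᶜ : ∀ {D E : N̄} {v z} → pred D v → z < v → ¬ pred E z → E <ᶜ D
  ∈∉⇒<ᶜ {D} {E} {v} {z} dv zv nez =
    (λ x ex → cut-downClosed D v x (<-trans (∈∉⇒< (cut-downClosed E) ex nez) zv) dv) ,
    z , cut-downClosed D v z zv dv , nez

  -- equivalently, ↓ u <ᶜ e <ᶜ ↓ v
  CutBetween : L → L → N̄ → Set
  CutBetween u v e = pred e u × ∃ λ z → z < v × ¬ pred e z

module Principal (lem : ∀ {ℓ : Level} → ExcludedMiddle ℓ) (𝕃 : DenseLinearOrder) (k : Kind)
  (lower-↓ : ∀ l → LowerCond 𝕃 k (λ x → DenseLinearOrder._<_ 𝕃 x l)) where
  open Cuts lem 𝕃 k public

  ↓_ : L → N̄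
  ↓ l = cut (_< l) record
    { downClosed = λ x y y<x x<l → <-trans y<x x<l
    ; noMax      = λ x x<l → dense x<l
    ; notAll     = l , <-irrefl
    ; lowerCond  = lower-↓ l
    }

  ↓-mono : ∀ {x y} → x < y → (↓ x) <ᶜ (↓ y)
  ↓-mono {x} p = (λ z zx → <-trans zx p) , x , p , <-irrefl

  ↓-reflect : ∀ {x y} → (↓ x) <ᶜ (↓ y) → x < y
  ↓-reflect (_ , z , zy , z≮x) = ≮-<-trans z≮x zy

  ∈⇒↓<ᶜ : ∀ {x} (e : N̄) → pred e x → (↓ x) <ᶜ e
  ∈⇒↓<ᶜ {x} e ex = (λ z zx → cut-downClosed e x z zx ex) , x , ex , <-irrefl

  ↓<ᶜ⇒∈ : ∀ {x} (e : N̄) → (↓ x) <ᶜ e → pred e x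
  ↓<ᶜ⇒∈ {x} e (_ , z , ez , z≮x) with ≮⇒≥ z≮x
  ... | inj₁ xz   = cut-downClosed e z x xz ez
  ... | inj₂ refl = ez

  ∉⇒<ᶜ↓ : ∀ {w y} (e : N̄) → w < y → ¬ pred e w → e <ᶜ (↓ y)
  ∉⇒<ᶜ↓ {w} e w<y w∉e = (λ z ez → <-trans (∈∉⇒< (cut-downClosed e) ez w∉e) w<y) , w , w<y , w∉e

  ↓<ᶜ<ᶜ↓⇒CutBetween : ∀ {u x y v e} → u < x → y < v → (↓ x) <ᶜ e → e <ᶜ (↓ y) → CutBetween u v e
  ↓<ᶜ<ᶜ↓⇒CutBetween {e = e} u<x y<v ↓x<e (_ , z , z<y , z∉e) =
    cut-downClosed e _ _ u<x (↓<ᶜ⇒∈ e ↓x<e) , z , <-trans z<y y<v , z∉e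

  represents⇒≈ᶜ↓ : ∀ (c : N̄) l → Represents 𝕃 c l → c ≈ᶜ (↓ l)
  represents⇒≈ᶜ↓ c l r = r

  record Window (S : N̄ → Set) : Set₁ where
    field
      steps    : Ladder
      captures : ∀ e → CutBetween (Ladder.x₀ steps) (Ladder.x₃ steps) e → S e
    open Ladder steps public

    ↓-captured : ∀ {x} → x₀ < x → x < x₃ → S (↓ x)
    ↓-captured {x} p q = captures (↓ x) (p , x , q , <-irrefl)

  window : ∀ {S u v} → u < v → (∀ e → CutBetween u v e → S e) → Window S
  window u<v captures = record { steps = ladder u<v ; captures = captures }

module Gaps (lem : ∀ {ℓ : Level} → ExcludedMiddle ℓ) (𝕃 : DenseLinearOrder) (k : Kind)
  {m : ℕ} (b : Fin (suc m) → Cut 𝕃 k) (b-mono : ∀ {i j} → i F.< j → _<̄_ 𝕃 (b i) (b j)) where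
  open Cuts lem 𝕃 k

  n : ℕ
  n = suc m

  b-⊆ : ∀ {i j} → i F.≤ j → pred (b i) ⊆ pred (b j)
  b-⊆ {i} {j} i≤j with ℕP.m≤n⇒m<n∨m≡n i≤j
  ... | inj₁ i<j = proj₁ (b-mono i<j)
  ... | inj₂ e with FP.toℕ-injective {i = i} {j = j} e
  ... | refl = λ x d → d

  AtHeight : ℕ → L → Set
  AtHeight h x = ∀ i → (toℕ i ℕ.< h → ¬ pred (b i) x) × (h ℕ.≤ toℕ i → pred (b i) x)

  AtHeight-< : ∀ {h h′ x y} → AtHeight h x → AtHeight h′ y → h ℕ.< h′ → h′ ℕ.≤ n → x < y
  AtHeight-< {h} {h′} hx hy lt le =
    let i = F.fromℕ< (ℕP.<-≤-trans lt le)
        toℕ-i = FP.toℕ-fromℕ< (ℕP.<-≤-trans lt le)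
    in ∈∉⇒< (cut-downClosed (b i)) (proj₂ (hx i) (ℕP.≤-reflexive (sym toℕ-i)))
                                   (proj₁ (hy i) (subst (ℕ._< h′) (sym toℕ-i) lt))

  -- a ladder between b (height - 1) and b height; height 0 is below every b i, height n above
  record Gap : Set where
    field
      height   : ℕ
      steps    : Ladder
      x₀-above : ∀ i → toℕ i ℕ.< height → ¬ pred (b i) (Ladder.x₀ steps)
      x₃-below : ∀ i → height ℕ.≤ toℕ i → pred (b i) (Ladder.x₃ steps)
    open Ladder steps public

    InStep⇒AtHeight : ∀ t {x} → InStep t x → AtHeight height x
    InStep⇒AtHeight t {x} h i =
      let (x₀<x , x<x₃) = InStep⇒inside t h in
      (λ lt d → x₀-above i lt (cut-downClosed (b i) x x₀ x₀<x d)) ,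
      (λ le → cut-downClosed (b i) x₃ x x<x₃ (x₃-below i le))

  ladderAbove : (D : N̄) → ∀ w → pred D w → Σ Ladder λ ℓ → pred D (Ladder.x₃ ℓ)
  ladderAbove D w d =
    let (x₁ , p₁ , d₁) = cut-noMax D w d
        (x₂ , p₂ , d₂) = cut-noMax D x₁ d₁
        (x₃ , p₃ , d₃) = cut-noMax D x₂ d₂
    in record { x₀ = w ; x₁ = x₁ ; x₂ = x₂ ; x₃ = x₃ ; x₀<x₁ = p₁ ; x₁<x₂ = p₂ ; x₂<x₃ = p₃ } , d₃

  inner : ∀ h → suc h ℕ.< n → Gap
  inner h lt =
    let i = F.fromℕ< (ℕP.<-trans (ℕP.n<1+n h) lt)
        j = F.fromℕ< lt
        toℕ-i = FP.toℕ-fromℕ< (ℕP.<-trans (ℕP.n<1+n h) lt)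
        toℕ-j = FP.toℕ-fromℕ< lt
        (_ , w , jw , ¬iw) = b-mono {i} {j} (subst₂ ℕ._<_ (sym toℕ-i) (sym toℕ-j) (ℕP.n<1+n h))
        (st , jx₃) = ladderAbove (b j) w jw
    in record
      { height   = suc h
      ; steps    = st
      ; x₀-above = λ i′ lt′ d → ¬iw (b-⊆ (subst (toℕ i′ ℕ.≤_) (sym toℕ-i) (ℕP.m<1+n⇒m≤n lt′)) w d)
      ; x₃-below = λ i′ le → b-⊆ (subst (ℕ._≤ toℕ i′) (sym toℕ-j) le) _ jx₃
      }

  bottom : ∀ w → pred (b 0F) w → Gap
  bottom w d =
    let (st , x₃∈b₀) = ladderAbove (b 0F) w d in
    record { height = 0 ; steps = st ; x₀-above = λ i () ; x₃-below = λ i _ → b-⊆ z≤n _ x₃∈b₀ }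

  top : ∀ {w y} → ¬ pred (b (F.fromℕ m)) w → w < y → Gap
  top ¬w w<y = record
    { height   = n
    ; steps    = ladder w<y
    ; x₀-above = λ i lt d → ¬w (b-⊆ (subst (toℕ i ℕ.≤_) (sym (FP.toℕ-fromℕ m)) (ℕP.≤-pred lt)) _ d)
    ; x₃-below = λ i le → ⊥-elim (ℕP.<⇒≱ (FP.toℕ<n i) le)
    }

  Key : Set
  Key = ℕ × Fin 3

  _<ᵏ_ : Rel Key 0ℓ
  _<ᵏ_ = ×-Lex _≡_ ℕ._<_ F._<_

  ≤-<ᵏ : ∀ {h h′ t t′} → h ℕ.≤ h′ → t F.< t′ → (h , t) <ᵏ (h′ , t′)
  ≤-<ᵏ le lt with ℕP.m≤n⇒m<n∨m≡n le
  ... | inj₁ h<h′ = inj₁ h<h′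
  ... | inj₂ refl = inj₂ (refl , lt)

  -- the three sources attached to b i: step 2 of the gap below b i, steps 0 and 1 of the gap above
  sourceStep : Fin 3 → Fin 3
  sourceStep 0F = 2F
  sourceStep 1F = 0F
  sourceStep 2F = 1F

  sourceHeight : Fin n → Fin 3 → ℕ
  sourceHeight i 0F        = toℕ i
  sourceHeight i (F.suc _) = suc (toℕ i)

  sourceKey : Fin n × Fin 3 → Key
  sourceKey (i , t) = sourceHeight i t , sourceStep t

  sourceKey-mono : ∀ {p q} → p <ₗₑₓ q → sourceKey p <ᵏ sourceKey q
  sourceKey-mono {_ , 0F}      {_ , 0F}      (inj₁ lt) = inj₁ lt
  sourceKey-mono {_ , 0F}      {_ , F.suc _} (inj₁ lt) = inj₁ (ℕP.m<n⇒m<1+n lt)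
  sourceKey-mono {_ , F.suc _} {_ , F.suc _} (inj₁ lt) = inj₁ (s≤s lt)
  sourceKey-mono {_ , 1F}      {_ , 0F}      (inj₁ lt) = ≤-<ᵏ lt (s≤s z≤n)
  sourceKey-mono {_ , 2F}      {_ , 0F}      (inj₁ lt) = ≤-<ᵏ lt (s≤s (s≤s z≤n))
  sourceKey-mono {_ , 0F}      {_ , F.suc _} (inj₂ (refl , _)) = inj₁ (ℕP.n<1+n _)
  sourceKey-mono {_ , 1F}      {_ , 2F}      (inj₂ (refl , _)) = inj₂ (refl , s≤s z≤n)
  sourceKey-mono {_ , 1F}      {_ , 1F}      (inj₂ (refl , s≤s ()))
  sourceKey-mono {_ , 2F}      {_ , 1F}      (inj₂ (refl , s≤s ()))
  sourceKey-mono {_ , 2F}      {_ , 2F}      (inj₂ (refl , s≤s (s≤s ())))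

  gaps : (first last : Gap) → ℕ → Gap
  gaps first last zero    = first
  gaps first last (suc h) with suc h ℕP.<? n
  ... | yes lt = inner h lt
  ... | no _   = last

  height-gaps-inner : ∀ first last {h} → suc h ℕ.< n → Gap.height (gaps first last (suc h)) ≡ suc h
  height-gaps-inner _ _ {h} lt with suc h ℕP.<? n
  ... | yes _  = refl
  ... | no ¬lt = ⊥-elim (¬lt lt)

  height-gaps : ∀ first last {h} → suc h ℕ.≤ n → Gap.height last ≡ n → Gap.height (gaps first last (suc h)) ≡ suc h
  height-gaps _ _ {h} le e with suc h ℕP.<? n
  ... | yes _  = refl
  ... | no ¬lt = trans e (ℕP.≤-antisym (ℕP.≮⇒≥ ¬lt) le)

  module Placement (gap : ℕ → Gap) where
    InKey : Key → L → Set
    InKey (h , t) = Gap.InStep (gap h) t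

    ProperKey : Key → Set
    ProperKey (h , _) = Gap.height (gap h) ≡ h × h ℕ.≤ n

    InKey⇒AtHeight : ∀ {κ x} → ProperKey κ → InKey κ x → AtHeight (proj₁ κ) x
    InKey⇒AtHeight {h , t} (eh , _) hx = subst (λ z → AtHeight z _) eh (Gap.InStep⇒AtHeight (gap h) t hx)

    InKey⇒∉-below : ∀ {κ x} → ProperKey κ → InKey κ x → ∀ i → toℕ i ℕ.< proj₁ κ →
                    ∃ λ w → w < x × ¬ pred (b i) w
    InKey⇒∉-below {h , t} (eh , _) hx i lt =
      Gap.x₀ (gap h) , proj₁ (Gap.InStep⇒inside (gap h) t hx) ,
      Gap.x₀-above (gap h) i (subst (toℕ i ℕ.<_) (sym eh) lt)

    InKey-source⇒∈ : ∀ {i x} → ProperKey (sourceKey (i , 0F)) → InKey (sourceKey (i , 0F)) x → pred (b i) x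
    InKey-source⇒∈ {i} p hx = proj₂ (InKey⇒AtHeight {sourceKey (i , 0F)} p hx i) ℕP.≤-refl

    InKey-< : ∀ {κ κ′ x y} → κ <ᵏ κ′ → ProperKey κ → ProperKey κ′ → InKey κ x → InKey κ′ y → x < y
    InKey-< {κ} {κ′} (inj₁ lt) pκ pκ′ hx hy =
      AtHeight-< (InKey⇒AtHeight {κ} pκ hx) (InKey⇒AtHeight {κ′} pκ′ hy) lt (proj₂ pκ′)
    InKey-< {h , t} (inj₂ (refl , lt)) _ _ hx hy = Gap.InStep-< (gap h) lt hx hy

module LinearExtension (lem : ∀ {ℓ : Level} → ExcludedMiddle ℓ) (𝕃 : DenseLinearOrder) (k : Kind)
  (toLower   : ∀ {D : DenseLinearOrder.Carrier 𝕃 → Set} → ∃ D → LowerCond 𝕃 k D)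
  (fromLower : ∀ {D : DenseLinearOrder.Carrier 𝕃 → Set} → LowerCond 𝕃 k D → ∃ D) where
  open Cuts lem 𝕃 k

  module Extend (f f⁻¹ : L → L) (inverseˡ : ∀ y → f (f⁻¹ y) ≡ y) (inverseʳ : ∀ x → f⁻¹ (f x) ≡ x)
                (f-mono : ∀ {x y} → x < y → f x < f y) (f⁻¹-mono : ∀ {x y} → x < y → f⁻¹ x < f⁻¹ y) where

    extend : N̄ → N̄
    extend D = cut (λ y → pred D (f⁻¹ y)) record
      { downClosed = λ x y y<x → cut-downClosed D (f⁻¹ x) (f⁻¹ y) (f⁻¹-mono y<x)
      ; noMax      = λ x dx → let (z , p , dz) = cut-noMax D (f⁻¹ x) dx in
          f z , subst (_< f z) (inverseˡ x) (f-mono p) , subst (pred D) (sym (inverseʳ z)) dz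
      ; notAll     = let (z , nz) = cut-notAll D in f z , λ d → nz (subst (pred D) (inverseʳ z) d)
      ; lowerCond  = let (z , dz) = fromLower (IsCut.lowerCond (isCut D)) in
          toLower (f z , subst (pred D) (sym (inverseʳ z)) dz)
      }

    extend-cong : ∀ {D E} → D ≈ᶜ E → extend D ≈ᶜ extend E
    extend-cong e y = e (f⁻¹ y)

    extend-PresOrd : Generic.PresOrd _≈ᶜ_ _<ᶜ_ extend
    extend-PresOrd D E =
      (λ { (de , x , ex , ndx) → (λ y → de (f⁻¹ y)) , f x ,
             subst (pred E) (sym (inverseʳ x)) ex , (λ d → ndx (subst (pred D) (inverseʳ x) d)) }) ,
      (λ { (de , y , ey , ndy) →
             (λ x dx → subst (pred E) (inverseʳ x) (de (f x) (subst (pred D) (sym (inverseʳ x)) dx))) ,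
             f⁻¹ y , ey , ndy })

    extend-represents : ∀ (c : N̄) l → Represents 𝕃 c l → Represents 𝕃 (extend c) (f l)
    extend-represents c l r y =
      (λ d → subst (_< f l) (inverseˡ y) (f-mono (proj₁ (r (f⁻¹ y)) d))) ,
      (λ p → proj₂ (r (f⁻¹ y)) (subst (f⁻¹ y <_) (inverseʳ l) (f⁻¹-mono p)))

  module Completion (sense : ∀ h → Generic.PresOrd _≈ᶜ_ _<ᶜ_ h → Generic.Sense _≈ᶜ_ _<ᶜ_ k h)
                    (g : L ↔ L) (g-mono : Generic.PresOrd _≡_ _<_ (Inverse.to g)) where
    open Inverse g using (to; from; strictlyInverseˡ; strictlyInverseʳ) public

    to-mono : ∀ {x y} → x < y → to x < to y
    to-mono = proj₁ (g-mono _ _)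

    from-mono : ∀ {x y} → x < y → from x < from y
    from-mono {x} {y} p = proj₂ (g-mono (from x) (from y))
      (subst₂ _<_ (sym (strictlyInverseˡ x)) (sym (strictlyInverseˡ y)) p)

    private
      module E = Extend to from strictlyInverseˡ strictlyInverseʳ to-mono from-mono
      module E⁻¹ = Extend from to strictlyInverseʳ strictlyInverseˡ from-mono to-mono

    ḡ : BarAut 𝕃 k
    ḡ = record
      { fun = E.extend ; inv = E⁻¹.extend
      ; fun-cong = λ {a} {b} → E.extend-cong {a} {b}
      ; inv-cong = λ {a} {b} → E⁻¹.extend-cong {a} {b}
      ; inverseˡ = λ a y → subst (pred a) (strictlyInverseˡ y) , subst (pred a) (sym (strictlyInverseˡ y))
      ; inverseʳ = λ a y → subst (pred a) (strictlyInverseʳ y) , subst (pred a) (sym (strictlyInverseʳ y))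
      ; sense = sense E.extend E.extend-PresOrd
      }

    ḡ-extends : Extends 𝕃 g ḡ
    ḡ-extends = E.extend-represents

    ḡ-between : ∀ {D u v x y} → pred D x → ¬ pred D y → u < to x → to y < v → CutBetween u v (fun ḡ D)
    ḡ-between {D} {u} {v} {x} {y} dx ¬dy ux yv =
      cut-downClosed D x (from u) (subst (from u <_) (strictlyInverseʳ x) (from-mono ux)) dx ,
      to y , yv , λ d → ¬dy (subst (pred D) (strictlyInverseʳ y) d)

-- k is linear or monotonic; the parameters record what LowerCond, Sense and IsAut unfold to for such k
module LinearCase (lem : ∀ {ℓ : Level} → ExcludedMiddle ℓ) (𝕃 : DenseLinearOrder) (k : Kind)
  (toLower   : ∀ {D : DenseLinearOrder.Carrier 𝕃 → Set} → ∃ D → LowerCond 𝕃 k D)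
  (fromLower : ∀ {D : DenseLinearOrder.Carrier 𝕃 → Set} → LowerCond 𝕃 k D → ∃ D)
  (noMin : ¬ HasMin 𝕃) (noMax : ¬ HasMax 𝕃)
  (sense : ∀ h → Generic.PresOrd (_≈̄_ 𝕃 {k}) (_<̄_ 𝕃) h → Generic.Sense (_≈̄_ 𝕃 {k}) (_<̄_ 𝕃) k h)
  (G : DenseLinearOrder.Carrier 𝕃 ↔ DenseLinearOrder.Carrier 𝕃 → Set)
  (isG : IsNearlyOrderedPermGroup 𝕃 k G)
  (preserves⊎reverses : ∀ g → IsAut 𝕃 k g →
     Generic.PresOrd _≡_ (DenseLinearOrder._<_ 𝕃) (Inverse.to g) ⊎
     Generic.RevOrd _≡_ (DenseLinearOrder._<_ 𝕃) (Inverse.to g))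
  where
  open Principal lem 𝕃 k (λ l → toLower (Order.¬HasMin⇒below lem 𝕃 noMin l))
  open LinearExtension lem 𝕃 k toLower fromLower
  module GL = Generic {P = L} _≡_ _<_
  module GC = Generic _≈ᶜ_ _<ᶜ_

  ⟦_⟧ᴸ : GL.Interval lin → L → Set
  ⟦_⟧ᴸ = GL.⟦_⟧ {lin}

  ⟦_⟧ᶜ : GC.Interval lin → N̄ → Set
  ⟦_⟧ᶜ = GC.⟦_⟧ {lin}

  windowIn : ∀ J → Window ⟦ J ⟧ᶜ
  windowIn (lift (GC.bounded c d (_ , w , dw , ncw))) =
    let (v , wv , dv) = cut-noMax d w dw in
    window wv λ e (ew , z , zv , nez) → lift (∉∈⇒<ᶜ {c} {e} ncw ew , ∈∉⇒<ᶜ {d} {e} dv zv nez)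
  windowIn (lift (GC.above c)) =
    let (w , ncw) = cut-notAll c ; (v , wv) = ¬HasMax⇒above noMax w in
    window wv λ e (ew , _) → lift (∉∈⇒<ᶜ {c} {e} ncw ew)
  windowIn (lift (GC.below d)) =
    let (w , dw) = fromLower (IsCut.lowerCond (isCut d)) ; (v , wv , dv) = cut-noMax d w dw in
    window wv λ e (_ , z , zv , nez) → lift (∈∉⇒<ᶜ {d} {e} dv zv nez)
  windowIn (lift GC.univ) =
    let (u , v , uv) = nontrivial in window uv λ _ _ → lift _

  IntervalTransitiveˡ : Set
  IntervalTransitiveˡ = ∀ m (I J : Fin m → GL.Interval lin) →
    GL.OrderedSets lin (λ i → ⟦ I i ⟧ᴸ) → GL.OrderedSets lin (λ i → ⟦ J i ⟧ᴸ) →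
    ∃ λ g → G g × (∀ i → ∃ λ x → ⟦ I i ⟧ᴸ x × ⟦ J i ⟧ᴸ (Inverse.to g x))

  Approximates : ∀ {n} → (Fin n → N̄) → (Fin n → GC.Interval lin) → Set₁
  Approximates a J = ∃ λ g → G g × Σ (BarAut 𝕃 k) λ ḡ → Extends 𝕃 g ḡ × (∀ i → ⟦ J i ⟧ᶜ (fun ḡ (a i)))

  ApproxOTransitiveˡ : ℕ → Set₁
  ApproxOTransitiveˡ n = ∀ (a : Fin n → N̄) (J : Fin n → GC.Interval lin) →
    GC.OrderedPoints lin a → GC.OrderedSets lin (λ i → ⟦ J i ⟧ᶜ) → Approximates a J

  module Construction (hit : IntervalTransitiveˡ) {m} (a : Fin (suc m) → N̄) (J : Fin (suc m) → GC.Interval lin)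
    (a-mono : GC.OrderedPoints lin a) (J-ordered : GC.OrderedSets lin (λ i → ⟦ J i ⟧ᶜ)) where
    open Gaps lem 𝕃 k a (λ {i} {j} lt → lower a-mono i j lt)

    lowest highest : Gap
    lowest  = let (w , d) = fromLower (IsCut.lowerCond (isCut (a 0F))) in bottom w d
    highest = let (w , nw) = cut-notAll (a (F.fromℕ m)) ; (_ , wy) = ¬HasMax⇒above noMax w in top nw wy

    gap : ℕ → Gap
    gap = gaps lowest highest

    open Placement gap

    sourceKey-proper : ∀ p → ProperKey (sourceKey p)
    sourceKey-proper (i , 0F) with toℕ i in eq
    ... | zero  = refl , z≤n
    ... | suc h = let h<n = subst (ℕ._≤ n) eq (ℕP.<⇒≤ (FP.toℕ<n i)) in height-gaps lowest highest h<n refl , h<n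
    sourceKey-proper (i , F.suc _) = height-gaps lowest highest (FP.toℕ<n i) refl , FP.toℕ<n i

    source : Fin n × Fin 3 → GL.Interval lin
    source p = let open Gap (gap (proj₁ (sourceKey p))) ; t = proj₂ (sourceKey p) in
      lift (GL.bounded (lo t) (hi t) (lo<hi t))

    W : ∀ i → Window ⟦ J i ⟧ᶜ
    W i = windowIn (J i)

    target : Fin n × Fin 3 → GL.Interval lin
    target (i , t) = let open Window (W i) in lift (GL.bounded (lo t) (hi t) (lo<hi t))

    target-< : ∀ {p q x y} → p <ₗₑₓ q → Window.InStep (W (proj₁ p)) (proj₂ p) x →
               Window.InStep (W (proj₁ q)) (proj₂ q) y → x < y
    target-< {i , t} {j , s} (inj₁ lt) hx hy =
      let (x₀<x , x<x₃) = Window.InStep⇒inside (W i) t hx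
          (x₀<y , y<x₃) = Window.InStep⇒inside (W j) s hy
      in ↓-reflect (lower J-ordered i j lt _ _ (Window.↓-captured (W i) x₀<x x<x₃)
                                               (Window.↓-captured (W j) x₀<y y<x₃))
    target-< {i , _} (inj₂ (refl , lt)) hx hy = Window.InStep-< (W i) lt hx hy

    I T : Fin (n ℕ.* 3) → GL.Interval lin
    I q = source (F.remQuot 3 q)
    T q = target (F.remQuot 3 q)

    I-ordered : GL.OrderedSets lin (λ q → ⟦ I q ⟧ᴸ)
    I-ordered = lift λ p q lt _ _ hx hy →
      InKey-< (sourceKey-mono (remQuot-<ₗₑₓ 3 lt)) (sourceKey-proper (F.remQuot 3 p)) (sourceKey-proper (F.remQuot 3 q))
              (lower hx) (lower hy)

    T-ordered : GL.OrderedSets lin (λ q → ⟦ T q ⟧ᴸ)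
    T-ordered = lift λ p q lt _ _ hx hy →
      target-< {F.remQuot 3 p} {F.remQuot 3 q} (remQuot-<ₗₑₓ 3 lt) (lower hx) (lower hy)

    module _ (g : L ↔ L) (hits : ∀ q → ∃ λ x → ⟦ I q ⟧ᴸ x × ⟦ T q ⟧ᴸ (Inverse.to g x)) where
      open Inverse g using (to)

      hit-at : ∀ p → ∃ λ x → ⟦ source p ⟧ᴸ x × ⟦ target p ⟧ᴸ (to x)
      hit-at (i , t) = subst (λ p → ∃ λ x → ⟦ source p ⟧ᴸ x × ⟦ target p ⟧ᴸ (to x))
                             (FP.remQuot-combine i t) (hits (F.combine i t))

      not-reversing : ¬ GL.RevOrd to
      not-reversing rev =
        let (x , lift hx , lift gx) = hit-at (0F , 0F)
            (y , lift hy , lift gy) = hit-at (0F , 1F)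
            x<y = InKey-< (sourceKey-mono {0F , 0F} {0F , 1F} (inj₂ (refl , s≤s z≤n)))
                          (sourceKey-proper (0F , 0F)) (sourceKey-proper (0F , 1F)) hx hy
        in <-asym (proj₁ (rev x y) x<y) (Window.InStep-< (W 0F) {0F} {1F} (s≤s z≤n) gx gy)

      lands-in-J : (g-mono : GL.PresOrd to) → ∀ i → ⟦ J i ⟧ᶜ (fun (Completion.ḡ sense g g-mono) (a i))
      lands-in-J g-mono i =
        let open Completion sense g g-mono using (ḡ-between)
            (x , lift hx , lift (u<gx , _)) = hit-at (i , 0F)
            (y , lift hy , lift (_ , gy<x₂)) = hit-at (i , 1F)
            x∈aᵢ = InKey-source⇒∈ (sourceKey-proper (i , 0F)) hx
            y∉aᵢ = proj₁ (InKey⇒AtHeight {sourceKey (i , 1F)} (sourceKey-proper (i , 1F)) hy i) (ℕP.n<1+n _)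
        in Window.captures (W i) _ (ḡ-between {a i} x∈aᵢ y∉aᵢ u<gx (<-trans gy<x₂ (Window.x₂<x₃ (W i))))

    approximates : Approximates a J
    approximates with hit (n ℕ.* 3) I T I-ordered T-ordered
    ... | g , g∈G , hits with preserves⊎reverses g (IsNearlyOrderedPermGroup.⊆Aut isG g g∈G)
    ...   | inj₂ rev    = ⊥-elim (not-reversing g hits rev)
    ...   | inj₁ g-mono = g , g∈G , ḡ , ḡ-extends , lands-in-J g hits g-mono
      where open Completion sense g g-mono using (ḡ; ḡ-extends)

  approxOTransitiveˡ : IntervalTransitiveˡ → ∀ n → ApproxOTransitiveˡ n
  approxOTransitiveˡ hit zero    _ _ _ _ =
    ↔-id L , IsNearlyOrderedPermGroup.has-id isG , ḡ , ḡ-extends , λ ()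
    where open Completion sense (↔-id L) (λ _ _ → (λ p → p) , (λ p → p)) using (ḡ; ḡ-extends)
  approxOTransitiveˡ hit (suc m) a J a-mono J-ordered = Construction.approximates hit a J a-mono J-ordered

module CircularExtension (lem : ∀ {ℓ : Level} → ExcludedMiddle ℓ) (𝕃 : DenseLinearOrder) (k : Kind)
  (toLower   : ∀ {D : DenseLinearOrder.Carrier 𝕃 → Set} → (∃ D) ⊎ ¬ HasMax 𝕃 → LowerCond 𝕃 k D)
  (fromLower : ∀ {D : DenseLinearOrder.Carrier 𝕃 → Set} → LowerCond 𝕃 k D → (∃ D) ⊎ ¬ HasMax 𝕃) where
  open Cuts lem 𝕃 k
  open Cyclic _<_ using (Cr)

  -- the initial segment cut off by Y in the order listing the complement of X before X
  Arc : (L → Set) → (L → Set) → L → Set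
  Arc X Y z = (X ⊆ Y × Y z × ¬ X z) ⊎ (¬ (X ⊆ Y) × (Y z ⊎ ¬ X z))

  module Extend (f f⁻¹ : L → L) (inverseˡ : ∀ y → f (f⁻¹ y) ≡ y) (inverseʳ : ∀ x → f⁻¹ (f x) ≡ x)
              (f-Cr : ∀ {x y z} → Cr x y z → Cr (f x) (f y) (f z)) where

    f-injective : ∀ {x y} → f x ≡ f y → x ≡ y
    f-injective {x} {y} e = trans (sym (inverseʳ x)) (trans (cong f⁻¹ e) (inverseʳ y))

    -- the points f carries across the end of L: f is increasing on Wraps and on its complement,
    -- and maps the complement below Wraps
    Wraps : L → Set
    Wraps x = ∃ λ x′ → x < x′ × f x′ < f x

    Wraps-down : DownClosed Wraps
    Wraps-down x y y<x (x′ , xx′ , fx′x) with compare (f x) (f y)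
    ... | tri< p _ _ = x , y<x , p
    ... | tri≈ _ e _ = ⊥-elim (<⇒≢ y<x (sym (f-injective e)))
    ... | tri> _ _ p with f-Cr (inj₁ (y<x , xx′))
    ...   | inj₁ (a , b) = ⊥-elim (<-asym b fx′x)
    ...   | inj₂ (inj₁ (a , b)) = ⊥-elim (<-asym a fx′x)
    ...   | inj₂ (inj₂ (a , b)) = x′ , <-trans y<x xx′ , a

    f-<-unwrapped : ∀ {x x′} → ¬ Wraps x → x < x′ → f x < f x′
    f-<-unwrapped {x} {x′} nb p with compare (f x) (f x′)
    ... | tri< q _ _ = q
    ... | tri≈ _ e _ = ⊥-elim (<⇒≢ p (f-injective e))
    ... | tri> _ _ q = ⊥-elim (nb (x′ , p , q))

    f-<-wrapped : ∀ {x x′} → Wraps x′ → x < x′ → f x < f x′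
    f-<-wrapped (x″ , p′ , q′) p with f-Cr (inj₁ (p , p′))
    ... | inj₁ (a , b) = a
    ... | inj₂ (inj₁ (a , b)) = ⊥-elim (<-asym a q′)
    ... | inj₂ (inj₂ (a , b)) = b

    f-<-across : ∀ {x x′} → ¬ Wraps x → Wraps x′ → f x < f x′
    f-<-across {x} {x′} nb bx′@(x″ , p′ , q′) with ∈∉⇒< Wraps-down bx′ nb | compare x″ x
    ... | x′x | tri≈ _ refl _ = q′
    ... | x′x | tri> _ _ xx″ = <-trans (f-<-unwrapped nb xx″) q′
    ... | x′x | tri< x″x _ _ with f-Cr (inj₁ (p′ , x″x))
    ...   | inj₁ (a , b) = ⊥-elim (<-asym a q′)
    ...   | inj₂ (inj₁ (a , b)) = b
    ...   | inj₂ (inj₂ (a , b)) = ⊥-elim (<-asym b q′)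

    Before : L → L → Set
    Before x′ x = (¬ Wraps x′ × Wraps x) ⊎ (¬ Wraps x′ × ¬ Wraps x × x′ < x) ⊎ (Wraps x′ × Wraps x × x′ < x)

    Before⇒f< : ∀ {x′ x} → Before x′ x → f x′ < f x
    Before⇒f< (inj₁ (a , b)) = f-<-across a b
    Before⇒f< (inj₂ (inj₁ (a , b , c))) = f-<-unwrapped a c
    Before⇒f< (inj₂ (inj₂ (a , b , c))) = f-<-wrapped b c

    f<⇒Before : ∀ {x′ x} → f x′ < f x → Before x′ x
    f<⇒Before {x′} {x} p with decide (Wraps x′) | decide (Wraps x)
    ... | yes bx′ | no nbx = ⊥-elim (<-asym p (f-<-across nbx bx′))
    ... | no nbx′ | yes bx = inj₁ (nbx′ , bx)
    ... | no nbx′ | no nbx with compare x′ x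
    ...   | tri< q _ _ = inj₂ (inj₁ (nbx′ , nbx , q))
    ...   | tri≈ _ refl _ = ⊥-elim (<-irrefl p)
    ...   | tri> _ _ q = ⊥-elim (<-asym p (f-<-unwrapped nbx q))
    f<⇒Before {x′} {x} p | yes bx′ | yes bx with compare x′ x
    ...   | tri< q _ _ = inj₂ (inj₂ (bx′ , bx , q))
    ...   | tri≈ _ refl _ = ⊥-elim (<-irrefl p)
    ...   | tri> _ _ q = ⊥-elim (<-asym p (f-<-wrapped bx′ q))

    max∉Wraps : ∀ {m} → (∀ x → ¬ m < x) → ¬ Wraps m
    max∉Wraps h (x , p , _) = h x p

    module _ (D : N̄) where
      Arc-down : ∀ {x′ x} → Before x′ x → Arc Wraps (pred D) x → Arc Wraps (pred D) x′
      Arc-down (inj₁ (_ , bx)) (inj₁ (_ , _ , nbx)) = ⊥-elim (nbx bx)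
      Arc-down (inj₂ (inj₁ (nbx′ , _ , p))) (inj₁ (a , dx , _)) = inj₁ (a , cut-downClosed D _ _ p dx , nbx′)
      Arc-down (inj₂ (inj₂ (_ , bx , _))) (inj₁ (_ , _ , nbx)) = ⊥-elim (nbx bx)
      Arc-down (inj₁ (nbx′ , _)) (inj₂ (a , _)) = inj₂ (a , inj₂ nbx′)
      Arc-down (inj₂ (inj₁ (nbx′ , _ , _))) (inj₂ (a , _)) = inj₂ (a , inj₂ nbx′)
      Arc-down (inj₂ (inj₂ (_ , bx , p))) (inj₂ (a , inj₁ dx)) = inj₂ (a , inj₁ (cut-downClosed D _ _ p dx))
      Arc-down (inj₂ (inj₂ (_ , bx , p))) (inj₂ (a , inj₂ nbx)) = ⊥-elim (nbx bx)

      ⊆Wraps : ¬ (Wraps ⊆ pred D) → pred D ⊆ Wraps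
      ⊆Wraps n with ⊆-total Wraps-down (cut-downClosed D)
      ... | inj₁ p = ⊥-elim (n p)
      ... | inj₂ p = p

      Arc-noMax : ∀ x → Arc Wraps (pred D) x → ∃ λ x″ → Before x x″ × Arc Wraps (pred D) x″
      Arc-noMax x (inj₁ (a , dx , nbx)) =
        let (x″ , p , dx″) = cut-noMax D x dx in
        x″ , inj₂ (inj₁ (nbx , (λ bx″ → nbx (Wraps-down x″ x p bx″)) , p)) ,
        inj₁ (a , dx″ , λ bx″ → nbx (Wraps-down x″ x p bx″))
      Arc-noMax x (inj₂ (a , h)) with decide (Wraps x)
      ... | yes bx = let dx = (D∋x h) ; (x″ , p , dx″) = cut-noMax D x dx in
            x″ , inj₂ (inj₂ (bx , ⊆Wraps a x″ dx″ , p)) , inj₂ (a , inj₁ dx″)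
        where D∋x : pred D x ⊎ ¬ Wraps x → pred D x
              D∋x (inj₁ d) = d
              D∋x (inj₂ n) = ⊥-elim (n bx)
      ... | no nbx with decide (∃ λ z → x < z)
      ...   | yes (z , p) = let nbz = λ bz → nbx (Wraps-down z x p bz) in
              z , inj₂ (inj₁ (nbx , nbz , p)) , inj₂ (a , inj₂ nbz)
      ...   | no nz with fromLower (IsCut.lowerCond (isCut D))
      ...     | inj₂ nmax = ⊥-elim (nmax (x , λ y p → nz (y , p)))
      ...     | inj₁ (d , dd) = d , inj₁ (nbx , ⊆Wraps a d dd) , inj₂ (a , inj₁ dd)

      Arc-notAll : ∃ λ x → ¬ Arc Wraps (pred D) x
      Arc-notAll with decide (Wraps ⊆ pred D)
      ... | yes bd = let (z , nz) = cut-notAll D in z , λ { (inj₁ (_ , dz , _)) → nz dz ; (inj₂ (n , _)) → n bd }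
      ... | no nbd = let (z , bz , nz) = ⊈⇒∃ nbd in z ,
            λ { (inj₁ (p , _ , _)) → nbd p ; (inj₂ (_ , inj₁ dz)) → nz dz ; (inj₂ (_ , inj₂ nbz)) → nbz bz }

      Arc-lower : (∃ λ x → Arc Wraps (pred D) x) ⊎ ¬ HasMax 𝕃
      Arc-lower with decide (HasMax 𝕃)
      ... | no nm = inj₂ nm
      ... | yes (M , isM) with fromLower (IsCut.lowerCond (isCut D))
      ...   | inj₂ nm = ⊥-elim (nm (M , isM))
      ...   | inj₁ (d , dd) with decide (Wraps ⊆ pred D)
      ...     | no nbd = inj₁ (M , inj₂ (nbd , inj₂ (max∉Wraps isM)))
      ...     | yes bd = inj₁ (¬¬-elim λ h → D⊈Wraps (λ x dx → ¬¬-elim λ nbx → h (x , inj₁ (bd , dx , nbx))))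
        where
        D⊈Wraps : ¬ (pred D ⊆ Wraps)
        D⊈Wraps DB with decide (Wraps (f⁻¹ M))
        ... | yes bc = let (c′ , p , dc′) = cut-noMax D (f⁻¹ M) (bd _ bc) in
                       isM (f c′) (subst (_< f c′) (inverseˡ M) (f-<-wrapped (DB c′ dc′) p))
        ... | no nbc = isM (f d) (subst (_< f d) (inverseˡ M) (f-<-across nbc (DB d dd)))

    extend-isCut : (D : N̄) → IsCut 𝕃 k (λ y → Arc Wraps (pred D) (f⁻¹ y))
    extend-isCut D = record
      { downClosed = λ y y′ y′<y →
          Arc-down D (f<⇒Before (subst₂ _<_ (sym (inverseˡ y′)) (sym (inverseˡ y)) y′<y))
      ; noMax = λ y h → let (x″ , l , a) = Arc-noMax D (f⁻¹ y) h in
          f x″ , subst (_< f x″) (inverseˡ y) (Before⇒f< l) , subst (Arc Wraps (pred D)) (sym (inverseʳ x″)) a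
      ; notAll = let (z , nz) = Arc-notAll D in f z , λ a → nz (subst (Arc Wraps (pred D)) (inverseʳ z) a)
      ; lowerCond = toLower (lower′ (Arc-lower D))
      }
      where lower′ : (∃ λ x → Arc Wraps (pred D) x) ⊎ ¬ HasMax 𝕃 →
                     (∃ λ y → Arc Wraps (pred D) (f⁻¹ y)) ⊎ ¬ HasMax 𝕃
            lower′ (inj₁ (x , a)) = inj₁ (f x , subst (Arc Wraps (pred D)) (sym (inverseʳ x)) a)
            lower′ (inj₂ n) = inj₂ n

    extend : N̄ → N̄
    extend D = cut (λ y → Arc Wraps (pred D) (f⁻¹ y)) (extend-isCut D)

    Arc-cong : ∀ {X D E : L → Set} {x} → D ⊆ E → E ⊆ D → Arc X D x → Arc X E x
    Arc-cong de ed (inj₁ (xd , dx , nx)) = inj₁ ((λ z xz → de z (xd z xz)) , de _ dx , nx)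
    Arc-cong de ed (inj₂ (nxd , inj₁ dx)) = inj₂ ((λ xe → nxd λ z xz → ed z (xe z xz)) , inj₁ (de _ dx))
    Arc-cong de ed (inj₂ (nxd , inj₂ nx)) = inj₂ ((λ xe → nxd λ z xz → ed z (xe z xz)) , inj₂ nx)

    extend-cong : ∀ {D E : N̄} → D ≈ᶜ E → extend D ≈ᶜ extend E
    extend-cong {D} {E} e y = Arc-cong (λ z → proj₁ (e z)) (λ z → proj₂ (e z))
                         , Arc-cong (λ z → proj₂ (e z)) (λ z → proj₁ (e z))

    WrapsIn : N̄ → Set
    WrapsIn D = Wraps ⊆ pred D

    ¬WrapsIn<WrapsIn : ∀ {D E : N̄} → ¬ WrapsIn D → WrapsIn E → D <ᶜ E
    ¬WrapsIn<WrapsIn {D} {E} nad ae = let (b , bb , nd) = ⊈⇒∃ nad in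
      (λ x dx → ae x (⊆Wraps D nad x dx)) , b , ae b bb , nd

    module R = MoveToFront _<ᶜ_ WrapsIn (λ D → decide _) (λ {x} {y} → <ᶜ-asym {x} {y})
                           (λ {x} {y} → ¬WrapsIn<WrapsIn {x} {y})

    f⁻¹-f : ∀ {P : L → Set} {x} → P x → P (f⁻¹ (f x))
    f⁻¹-f {P} {x} p = subst P (sym (inverseʳ x)) p

    <ᴬ⇒extend< : ∀ {D E : N̄} → D R.<ᴬ E → extend D <ᶜ extend E
    <ᴬ⇒extend< {D} {E} (inj₁ (ad , ae , de , z , ez , ndz)) =
      (λ y → λ { (inj₁ (_ , dx , nbx)) → inj₁ (ae , de _ dx , nbx) ; (inj₂ (n , _)) → ⊥-elim (n ad) })
      , f z , f⁻¹-f {Arc Wraps (pred E)} (inj₁ (ae , ez , λ bz → ndz (ad z bz)))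
      , λ h → z∉Arc (subst (Arc Wraps (pred D)) (inverseʳ z) h)
      where z∉Arc : ¬ Arc Wraps (pred D) z
            z∉Arc (inj₁ (_ , dz , _)) = ndz dz
            z∉Arc (inj₂ (n , _)) = n ad
    <ᴬ⇒extend< {D} {E} (inj₂ (inj₁ (nad , nae , de , z , ez , ndz))) =
      (λ y → λ { (inj₁ (a , _ , _)) → ⊥-elim (nad a) ; (inj₂ (_ , inj₁ dx)) → inj₂ (nae , inj₁ (de _ dx))
               ; (inj₂ (_ , inj₂ nbx)) → inj₂ (nae , inj₂ nbx) })
      , f z , f⁻¹-f {Arc Wraps (pred E)} (inj₂ (nae , inj₁ ez))
      , λ h → z∉Arc (subst (Arc Wraps (pred D)) (inverseʳ z) h)
      where z∉Arc : ¬ Arc Wraps (pred D) z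
            z∉Arc (inj₁ (a , _ , _)) = nad a
            z∉Arc (inj₂ (_ , inj₁ dz)) = ndz dz
            z∉Arc (inj₂ (_ , inj₂ nbz)) = nbz (⊆Wraps E nae z ez)
    <ᴬ⇒extend< {D} {E} (inj₂ (inj₂ (ad , nae))) =
      (λ y → λ { (inj₁ (_ , _ , nbx)) → inj₂ (nae , inj₂ nbx) ; (inj₂ (n , _)) → ⊥-elim (n ad) })
      , f z , f⁻¹-f {Arc Wraps (pred E)} (inj₂ (nae , inj₂ (λ bz → nz (ad z bz))))
      , λ h → z∉Arc (subst (Arc Wraps (pred D)) (inverseʳ z) h)
      where z = proj₁ (cut-notAll D)
            nz = proj₂ (cut-notAll D)
            z∉Arc : ¬ Arc Wraps (pred D) z
            z∉Arc (inj₁ (_ , dz , _)) = nz dz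
            z∉Arc (inj₂ (n , _)) = n ad

    extend<⇒<ᴬ : ∀ {D E : N̄} → extend D <ᶜ extend E → D R.<ᴬ E
    extend<⇒<ᴬ {D} {E} (sub , y , hE , nhD) with decide (WrapsIn D) | decide (WrapsIn E)
    ... | yes ad | yes ae = inj₁ (ad , ae , D⊆E , E∖D hE nhD)
      where
      D⊆E : ∀ x → pred D x → pred E x
      D⊆E x dx with decide (Wraps x)
      ... | yes bx = ae x bx
      ... | no nbx with subst (Arc Wraps (pred E)) (inverseʳ x) (sub (f x) (f⁻¹-f {Arc Wraps (pred D)} (inj₁ (ad , dx , nbx))))
      ...   | inj₁ (_ , ex , _) = ex
      ...   | inj₂ (n , _) = ⊥-elim (n ae)
      E∖D : Arc Wraps (pred E) (f⁻¹ y) → ¬ Arc Wraps (pred D) (f⁻¹ y) → ∃ λ z → pred E z × ¬ pred D z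
      E∖D (inj₁ (_ , ez , nbz)) n = f⁻¹ y , ez , λ dz → n (inj₁ (ad , dz , nbz))
      E∖D (inj₂ (m , _)) n = ⊥-elim (m ae)
    ... | no nad | no nae = inj₂ (inj₁ (nad , nae , D⊆E , E∖D hE nhD))
      where
      D⊆E : ∀ x → pred D x → pred E x
      D⊆E x dx with subst (Arc Wraps (pred E)) (inverseʳ x) (sub (f x) (f⁻¹-f {Arc Wraps (pred D)} (inj₂ (nad , inj₁ dx))))
      ... | inj₁ (a , _ , _) = ⊥-elim (nae a)
      ... | inj₂ (_ , inj₁ ex) = ex
      ... | inj₂ (_ , inj₂ nbx) = ⊥-elim (nbx (⊆Wraps D nad x dx))
      E∖D : Arc Wraps (pred E) (f⁻¹ y) → ¬ Arc Wraps (pred D) (f⁻¹ y) → ∃ λ z → pred E z × ¬ pred D z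
      E∖D (inj₁ (a , _ , _)) n = ⊥-elim (nae a)
      E∖D (inj₂ (_ , inj₁ ez)) n = f⁻¹ y , ez , λ dz → n (inj₂ (nad , inj₁ dz))
      E∖D (inj₂ (_ , inj₂ nbz)) n = ⊥-elim (n (inj₂ (nad , inj₂ nbz)))
    ... | yes ad | no nae = inj₂ (inj₂ (ad , nae))
    ... | no nad | yes ae = ⊥-elim (z∉Arc (subst (Arc Wraps (pred E)) (inverseʳ z)
                                      (sub (f z) (f⁻¹-f {Arc Wraps (pred D)} (inj₂ (nad , inj₂ nbz))))))
      where
      z = proj₁ (cut-notAll E)
      nz = proj₂ (cut-notAll E)
      nbz : ¬ Wraps z
      nbz bz = nz (ae z bz)
      z∉Arc : ¬ Arc Wraps (pred E) z
      z∉Arc (inj₁ (_ , ez , _)) = nz ez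
      z∉Arc (inj₂ (n , _)) = n ae

    extend-PresCr : Generic.PresCr _≈ᶜ_ _<ᶜ_ extend
    extend-PresCr D E F =
      (λ c → Cr-map {_<_ = R._<ᴬ_} {_<′_ = _<ᶜ_} extend (λ {u} {v} → <ᴬ⇒extend< {u} {v}) {D} {E} {F}
                    (R.Cr⇒Crᴬ D E F c)) ,
      (λ c → R.Crᴬ⇒Cr D E F
               (Cr-reflect {_<_ = R._<ᴬ_} {_<′_ = _<ᶜ_} extend (λ {u} {v} → extend<⇒<ᴬ {u} {v}) {D} {E} {F} c))

    extend-represents : ∀ (c : N̄) l → Represents 𝕃 c l → Represents 𝕃 (extend c) (f l)
    extend-represents c l r y = Arc⇒< , <⇒Arc
      where
      x = f⁻¹ y
      fxy : f x ≡ y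
      fxy = inverseˡ y
      Wraps⊆c : ¬ Wraps l → Wraps ⊆ pred c
      Wraps⊆c nbl z bz = proj₂ (r z) (∈∉⇒< Wraps-down bz nbl)
      Wraps⊈c : Wraps l → ¬ (Wraps ⊆ pred c)
      Wraps⊈c bl bc = <-irrefl (proj₁ (r l) (bc l bl))
      Arc⇒Before : Arc Wraps (pred c) x → Before x l
      Arc⇒Before (inj₁ (bc , cx , nbx)) with decide (Wraps l)
      ... | yes bl = inj₁ (nbx , bl)
      ... | no nbl = inj₂ (inj₁ (nbx , nbl , proj₁ (r x) cx))
      Arc⇒Before (inj₂ (nbc , h′)) with ¬¬-elim (λ nbl → nbc (Wraps⊆c nbl)) | h′
      ... | bl | inj₂ nbx = inj₁ (nbx , bl)
      ... | bl | inj₁ cx with decide (Wraps x)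
      ...   | yes bx = inj₂ (inj₂ (bx , bl , proj₁ (r x) cx))
      ...   | no nbx = inj₁ (nbx , bl)
      Arc⇒< : Arc Wraps (pred c) x → y < f l
      Arc⇒< h = subst (_< f l) fxy (Before⇒f< (Arc⇒Before h))
      Before⇒Arc : Before x l → Arc Wraps (pred c) x
      Before⇒Arc (inj₁ (nbx , bl)) = inj₂ (Wraps⊈c bl , inj₂ nbx)
      Before⇒Arc (inj₂ (inj₁ (nbx , nbl , xl))) = inj₁ (Wraps⊆c nbl , proj₂ (r x) xl , nbx)
      Before⇒Arc (inj₂ (inj₂ (bx , bl , xl))) = inj₂ (Wraps⊈c bl , inj₁ (proj₂ (r x) xl))
      <⇒Arc : y < f l → Arc Wraps (pred c) x
      <⇒Arc p = Before⇒Arc (f<⇒Before (subst (_< f l) (sym fxy) p))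

  module ExtendInverse (f f⁻¹ : L → L) (inverseˡ : ∀ y → f (f⁻¹ y) ≡ y) (inverseʳ : ∀ x → f⁻¹ (f x) ≡ x)
                (f-Cr : ∀ {x y z} → Cr x y z → Cr (f x) (f y) (f z))
                (f⁻¹-Cr : ∀ {x y z} → Cr x y z → Cr (f⁻¹ x) (f⁻¹ y) (f⁻¹ z)) where
    module E = Extend f f⁻¹ inverseˡ inverseʳ f-Cr
    module E⁻¹ = Extend f⁻¹ f inverseʳ inverseˡ f⁻¹-Cr

    Wraps⁻¹⇒ : ∀ y → E⁻¹.Wraps y → (∃ E.Wraps) × ¬ E.Wraps (f⁻¹ y)
    Wraps⁻¹⇒ y (y′ , p , q) with E.f<⇒Before {f⁻¹ y} {f⁻¹ y′} (subst₂ _<_ (sym (inverseˡ y)) (sym (inverseˡ y′)) p)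
    ... | inj₁ (nb , b) = (f⁻¹ y′ , b) , nb
    ... | inj₂ (inj₁ (_ , _ , r)) = ⊥-elim (<-asym r q)
    ... | inj₂ (inj₂ (_ , _ , r)) = ⊥-elim (<-asym r q)

    ⇒Wraps⁻¹ : ∀ y → (∃ E.Wraps) → ¬ E.Wraps (f⁻¹ y) → E⁻¹.Wraps y
    ⇒Wraps⁻¹ y (b , bb) nb =
      f b , subst (_< f b) (inverseˡ y) (E.f-<-across nb bb) ,
      subst (_< f⁻¹ y) (sym (inverseʳ b)) (∈∉⇒< E.Wraps-down bb nb)

    module _ (D : N̄) where
      Image : L → Set
      Image y = Arc E.Wraps (pred D) (f⁻¹ y)

      Image-f : ∀ {x} → Image (f x) → Arc E.Wraps (pred D) x
      Image-f {x} h = subst (Arc E.Wraps (pred D)) (inverseʳ x) h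
      f-Image : ∀ {x} → Arc E.Wraps (pred D) x → Image (f x)
      f-Image {x} h = subst (Arc E.Wraps (pred D)) (sym (inverseʳ x)) h

      ∉Wraps-f⁻¹f : ∀ {x} → ¬ E.Wraps x → ¬ E.Wraps (f⁻¹ (f x))
      ∉Wraps-f⁻¹f {x} n b = n (subst E.Wraps (inverseʳ x) b)
      ∈Wraps-f⁻¹f : ∀ {x} → E.Wraps x → E.Wraps (f⁻¹ (f x))
      ∈Wraps-f⁻¹f {x} b = subst E.Wraps (sym (inverseʳ x)) b

      Wraps⁻¹⊈ : (∃ E.Wraps) → E.Wraps ⊆ pred D → ¬ (E⁻¹.Wraps ⊆ Image)
      Wraps⁻¹⊈ e bd b′Image with cut-notAll D
      ... | z , nz with Image-f (b′Image (f z) (⇒Wraps⁻¹ (f z) e (∉Wraps-f⁻¹f (λ bz → nz (bd z bz)))))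
      ...   | inj₁ (_ , dz , _) = nz dz
      ...   | inj₂ (n , _) = n bd

      extend⁻¹-extend⇒ : ∀ x → Arc E⁻¹.Wraps Image (f x) → pred D x
      extend⁻¹-extend⇒ x h with decide (∃ E.Wraps) | decide (E.Wraps ⊆ pred D)
      extend⁻¹-extend⇒ x (inj₁ (_ , yfx , _)) | no ne | _ with Image-f yfx
      ... | inj₁ (_ , dx , _) = dx
      ... | inj₂ (n , _) = ⊥-elim (n (λ z bz → ⊥-elim (ne (z , bz))))
      extend⁻¹-extend⇒ x (inj₂ (n , _)) | no ne | _ = ⊥-elim (n (λ y b′y → ⊥-elim (ne (proj₁ (Wraps⁻¹⇒ y b′y)))))
      extend⁻¹-extend⇒ x (inj₁ (b′Image , _ , _)) | yes e | yes bd = ⊥-elim (Wraps⁻¹⊈ e bd b′Image)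
      extend⁻¹-extend⇒ x (inj₂ (_ , inj₁ yfx)) | yes e | yes bd with Image-f yfx
      ... | inj₁ (_ , dx , _) = dx
      ... | inj₂ (n , _) = ⊥-elim (n bd)
      extend⁻¹-extend⇒ x (inj₂ (_ , inj₂ nb′fx)) | yes e | yes bd =
        bd x (¬¬-elim λ nbx → nb′fx (⇒Wraps⁻¹ (f x) e (∉Wraps-f⁻¹f nbx)))
      extend⁻¹-extend⇒ x (inj₁ (_ , yfx , nb′fx)) | yes e | no nbd with Image-f yfx
      ... | inj₁ (bd′ , _ , _) = ⊥-elim (nbd bd′)
      ... | inj₂ (_ , inj₁ dx) = dx
      ... | inj₂ (_ , inj₂ nbx) = ⊥-elim (nb′fx (⇒Wraps⁻¹ (f x) e (∉Wraps-f⁻¹f nbx)))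
      extend⁻¹-extend⇒ x (inj₂ (n , _)) | yes e | no nbd =
        ⊥-elim (n (λ y b′y → inj₂ (nbd , inj₂ (proj₂ (Wraps⁻¹⇒ y b′y)))))

      extend⁻¹-extend⇐ : ∀ x → pred D x → Arc E⁻¹.Wraps Image (f x)
      extend⁻¹-extend⇐ x dx with decide (∃ E.Wraps) | decide (E.Wraps ⊆ pred D)
      ... | no ne | _ = inj₁ ((λ y b′y → ⊥-elim (ne (proj₁ (Wraps⁻¹⇒ y b′y))))
                            , f-Image (inj₁ ((λ z bz → ⊥-elim (ne (z , bz))) , dx , λ bx → ne (x , bx)))
                            , λ b′fx → ne (proj₁ (Wraps⁻¹⇒ _ b′fx)))
      ... | yes e | yes bd with decide (E.Wraps x)
      ...   | yes bx = inj₂ (Wraps⁻¹⊈ e bd , inj₂ (λ b′fx → proj₂ (Wraps⁻¹⇒ (f x) b′fx) (∈Wraps-f⁻¹f bx)))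
      ...   | no nbx = inj₂ (Wraps⁻¹⊈ e bd , inj₁ (f-Image (inj₁ (bd , dx , nbx))))
      extend⁻¹-extend⇐ x dx | yes e | no nbd =
        inj₁ ((λ y b′y → inj₂ (nbd , inj₂ (proj₂ (Wraps⁻¹⇒ y b′y))))
             , f-Image (inj₂ (nbd , inj₁ dx))
             , λ b′fx → proj₂ (Wraps⁻¹⇒ (f x) b′fx) (∈Wraps-f⁻¹f (E.⊆Wraps D nbd x dx)))

  module Completion (sense : ∀ h → Generic.PresCr _≈ᶜ_ _<ᶜ_ h → Generic.Sense _≈ᶜ_ _<ᶜ_ k h)
                    (g : L ↔ L) (g-Cr : Generic.PresCr _≡_ _<_ (Inverse.to g)) where
    open Inverse g using (to; from; strictlyInverseˡ; strictlyInverseʳ)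

    to-Cr : ∀ {x y z} → Cr x y z → Cr (to x) (to y) (to z)
    to-Cr = proj₁ (g-Cr _ _ _)

    from-Cr : ∀ {x y z} → Cr x y z → Cr (from x) (from y) (from z)
    from-Cr {x} {y} {z} c = proj₂ (g-Cr (from x) (from y) (from z)) (to∘from c)
      where
      to∘from : Cr x y z → Cr (to (from x)) (to (from y)) (to (from z))
      to∘from c rewrite strictlyInverseˡ x | strictlyInverseˡ y | strictlyInverseˡ z = c

    private
      module G = ExtendInverse to from strictlyInverseˡ strictlyInverseʳ to-Cr from-Cr
      module G⁻¹ = ExtendInverse from to strictlyInverseʳ strictlyInverseˡ from-Cr to-Cr

    ḡ : BarAut 𝕃 k
    ḡ = record
      { fun = G.E.extend ; inv = G.E⁻¹.extend
      ; fun-cong = λ {a} {b} → G.E.extend-cong {a} {b}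
      ; inv-cong = λ {a} {b} → G.E⁻¹.extend-cong {a} {b}
      ; inverseˡ = λ a x → G⁻¹.extend⁻¹-extend⇒ a x , G⁻¹.extend⁻¹-extend⇐ a x
      ; inverseʳ = λ a x → G.extend⁻¹-extend⇒ a x , G.extend⁻¹-extend⇐ a x
      ; sense = sense G.E.extend G.E.extend-PresCr
      }

    ḡ-extends : Extends 𝕃 g ḡ
    ḡ-extends = G.E.extend-represents

    ḡ-PresCr : Generic.PresCr _≈ᶜ_ _<ᶜ_ (fun ḡ)
    ḡ-PresCr = G.E.extend-PresCr

-- k is circular or monocircular; the parameters record what LowerCond, Sense and IsAut unfold to for such k
module CircularCase (lem : ∀ {ℓ : Level} → ExcludedMiddle ℓ) (𝕃 : DenseLinearOrder) (k : Kind)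
  (toLower   : ∀ {D : DenseLinearOrder.Carrier 𝕃 → Set} → (∃ D) ⊎ ¬ HasMax 𝕃 → LowerCond 𝕃 k D)
  (fromLower : ∀ {D : DenseLinearOrder.Carrier 𝕃 → Set} → LowerCond 𝕃 k D → (∃ D) ⊎ ¬ HasMax 𝕃)
  (endpoints : ¬ (HasMin 𝕃 × HasMax 𝕃))
  (sense : ∀ h → Generic.PresCr (_≈̄_ 𝕃 {k}) (_<̄_ 𝕃) h → Generic.Sense (_≈̄_ 𝕃 {k}) (_<̄_ 𝕃) k h)
  (G : DenseLinearOrder.Carrier 𝕃 ↔ DenseLinearOrder.Carrier 𝕃 → Set)
  (isG : IsNearlyOrderedPermGroup 𝕃 k G)
  (preserves⊎reverses : ∀ g → IsAut 𝕃 k g →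
     Generic.PresCr _≡_ (DenseLinearOrder._<_ 𝕃) (Inverse.to g) ⊎
     Generic.RevCr _≡_ (DenseLinearOrder._<_ 𝕃) (Inverse.to g))
  where
  open Principal lem 𝕃 k (λ l → toLower (Order.below⊎¬HasMax lem 𝕃 endpoints l))
  open CircularExtension lem 𝕃 k toLower fromLower
  open Cyclic _<_ using (Cr)
  open Cyclic _<ᶜ_ using () renaming (Cr to Crᶜ)
  module GL = Generic {P = L} _≡_ _<_
  module GC = Generic _≈ᶜ_ _<ᶜ_

  ⟦_⟧ᴸ : GL.Interval circ → L → Set
  ⟦_⟧ᴸ = GL.⟦_⟧ {circ}

  ⟦_⟧ᶜ : GC.Interval circ → N̄ → Set
  ⟦_⟧ᶜ = GC.⟦_⟧ {circ}

  Cr-↓-reflect : ∀ {x y z} → Crᶜ (↓ x) (↓ y) (↓ z) → Cr x y z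
  Cr-↓-reflect = Cr-reflect {_<_ = _<_} {_<′_ = _<ᶜ_} ↓_ ↓-reflect

  Cr⇒between : ∀ {l x h} → l < h → Cr l x h → l < x × x < h
  Cr⇒between l<h (inj₁ p)              = p
  Cr⇒between l<h (inj₂ (inj₁ (_ , q))) = ⊥-elim (<-asym l<h q)
  Cr⇒between l<h (inj₂ (inj₂ (q , _))) = ⊥-elim (<-asym l<h q)

  windowIn : ∀ J → (∃ λ e → ⟦ J ⟧ᶜ e) → Window ⟦ J ⟧ᶜ
  windowIn (lift (GC.arc c d _)) (e₀ , lift (inj₁ (c<e₀ , e₀<d))) =
    let (_ , w , dw , ncw) = <ᶜ-trans {c} {e₀} {d} c<e₀ e₀<d ; (v , wv , dv) = cut-noMax d w dw in
    window wv λ e (ew , z , zv , nez) → lift (inj₁ (∉∈⇒<ᶜ {c} {e} ncw ew , ∈∉⇒<ᶜ {d} {e} dv zv nez))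
  windowIn (lift (GC.arc c d _)) (e₀ , lift (inj₂ (inj₁ ((_ , w , dw , _) , d<c)))) =
    let (v , wv , dv) = cut-noMax d w dw in
    window wv λ e (_ , z , zv , nez) → lift (inj₂ (inj₁ (∈∉⇒<ᶜ {d} {e} dv zv nez , d<c)))
  windowIn (lift (GC.arc c d _)) (e₀ , lift (inj₂ (inj₂ (d<c , (_ , w , e₀w , ncw))))) =
    let (v , wv , _) = cut-noMax e₀ w e₀w in
    window wv λ e (ew , _) → lift (inj₂ (inj₂ (d<c , ∉∈⇒<ᶜ {c} {e} ncw ew)))
  windowIn (lift GC.whole) _ = let (u , v , uv) = nontrivial in window uv λ _ _ → _
  windowIn (lift (GC.punct p)) _ with decide (∃ λ w → pred p w)
  ... | yes (w , pw) = let (v , wv , pv) = cut-noMax p w pw in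
        window wv λ e (_ , z , zv , nez) → lift λ e≈p → nez (proj₂ (e≈p z) (cut-downClosed p v z zv pv))
  ... | no ¬p with fromLower (IsCut.lowerCond (isCut p))
  ...   | inj₁ x    = ⊥-elim (¬p x)
  ...   | inj₂ ¬max = let (u , _ , _) = nontrivial ; (v , uv) = ¬HasMax⇒above ¬max u in
        window uv λ e (eu , _) → lift λ e≈p → ¬p (u , proj₁ (e≈p u) eu)

  module Targets {n} (J : Fin n → GC.Interval circ) (J-ordered : GC.OrderedSets circ (λ r → ⟦ J r ⟧ᶜ)) where
    open CircularlyOrdered _≈ᶜ_ _<ᶜ_ (λ {D} {E} → ≈ᶜ-sym {D} {E}) (λ r → ⟦ J r ⟧ᶜ) J-ordered

    W : ∀ r → Window ⟦ J r ⟧ᶜ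
    W r = windowIn (J r) (proj₁ J-ordered r)

    Inside : Fin n → L → Set
    Inside r x = Window.x₀ (W r) < x × x < Window.x₃ (W r)

    InTarget : Fin n × Fin 3 → L → Set
    InTarget (r , t) = Window.InStep (W r) t

    InTarget⇒Inside : ∀ p {x} → InTarget p x → Inside (proj₁ p) x
    InTarget⇒Inside (r , t) = Window.InStep⇒inside (W r) t

    ↓-in-J : ∀ {r x} → Inside r x → ⟦ J r ⟧ᶜ (↓ x)
    ↓-in-J {r} (p , q) = Window.↓-captured (W r) p q

    windows-disjoint : ∀ {r r′ x} → r ≢ r′ → Inside r x → Inside r′ x → ⊥
    windows-disjoint {x = x} r≢r′ hx hx′ = ≉-selected r≢r′ (↓-in-J hx) (↓-in-J hx′) (≈ᶜ-refl {↓ x})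

    outside-window : ∀ {r r′ x y z} → r ≢ r′ → x < y → Inside r x → Inside r y → Inside r′ z → z < x ⊎ y < z
    outside-window {x = x} {y} {z} r≢r′ x<y hx hy hz with compare z x
    ... | tri< z<x _ _  = inj₁ z<x
    ... | tri≈ _ refl _ = ⊥-elim (windows-disjoint r≢r′ hx hz)
    ... | tri> _ _ x<z with compare z y
    ...   | tri> _ _ y<z  = inj₂ y<z
    ...   | tri≈ _ refl _ = ⊥-elim (windows-disjoint r≢r′ hy hz)
    ...   | tri< z<y _ _  = ⊥-elim (windows-disjoint r≢r′ (<-trans (proj₁ hx) x<z , <-trans z<y (proj₂ hy)) hz)

    Cr-targets : ∀ {p q s x y z} → p <ₗₑₓ q → q <ₗₑₓ s →
                 InTarget p x → InTarget q y → InTarget s z → Cr x y z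
    Cr-targets {p} {q} {s} (inj₁ a) (inj₁ b) hx hy hz =
      Cr-↓-reflect (Cr-selected a b (↓-in-J (InTarget⇒Inside p hx)) (↓-in-J (InTarget⇒Inside q hy))
                                    (↓-in-J (InTarget⇒Inside s hz)))
    Cr-targets {p@(r , _)} {q} {s} (inj₂ (refl , a)) (inj₁ b) hx hy hz
      with outside-window (FP.<⇒≢ b) (Window.InStep-< (W r) a hx hy)
             (InTarget⇒Inside p hx) (InTarget⇒Inside q hy) (InTarget⇒Inside s hz)
    ... | inj₁ z<x = inj₂ (inj₂ (z<x , Window.InStep-< (W r) a hx hy))
    ... | inj₂ y<z = inj₁ (Window.InStep-< (W r) a hx hy , y<z)
    Cr-targets {p} {q@(r , _)} {s} (inj₁ a) (inj₂ (refl , b)) hx hy hz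
      with outside-window (λ e → FP.<⇒≢ a (sym e)) (Window.InStep-< (W r) b hy hz)
             (InTarget⇒Inside q hy) (InTarget⇒Inside s hz) (InTarget⇒Inside p hx)
    ... | inj₁ x<y = inj₁ (x<y , Window.InStep-< (W r) b hy hz)
    ... | inj₂ z<x = inj₂ (inj₁ (Window.InStep-< (W r) b hy hz , z<x))
    Cr-targets {r , _} (inj₂ (refl , a)) (inj₂ (refl , b)) hx hy hz =
      inj₁ (Window.InStep-< (W r) a hx hy , Window.InStep-< (W r) b hy hz)

    ≢-targets : ∀ {p q x y} → p <ₗₑₓ q → InTarget p x → InTarget q y → x ≢ y
    ≢-targets {p} {q} (inj₁ a) hx hy refl =
      windows-disjoint (FP.<⇒≢ a) (InTarget⇒Inside p hx) (InTarget⇒Inside q hy)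
    ≢-targets {r , _} (inj₂ (refl , a)) hx hy = <⇒≢ (Window.InStep-< (W r) a hx hy)

    target : Fin n × Fin 3 → GL.Interval circ
    target (r , t) = let open Window (W r) in lift (GL.arc (lo t) (hi t) (<⇒≢ (lo<hi t)))

    T : Fin (n ℕ.* 3) → GL.Interval circ
    T q = target (F.remQuot 3 q)

    T-ordered : GL.OrderedSets circ (λ q → ⟦ T q ⟧ᴸ)
    T-ordered = nonempty , λ xs h →
      let inT : ∀ q → InTarget (F.remQuot 3 q) (xs q)
          inT q = let (r , t) = F.remQuot 3 q in Cr⇒between (Window.lo<hi (W r) t) (lower (h q))
      in (λ q₁ q₂ q₃ a b → Cr-targets (remQuot-<ₗₑₓ 3 a) (remQuot-<ₗₑₓ 3 b) (inT q₁) (inT q₂) (inT q₃)) ,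
         (λ q₁ q₂ a → ≢-targets (remQuot-<ₗₑₓ 3 a) (inT q₁) (inT q₂))
      where
      nonempty : ∀ q → ∃ λ x → ⟦ T q ⟧ᴸ x
      nonempty q = let (r , t) = F.remQuot 3 q ; (x , p , p′) = dense (Window.lo<hi (W r) t) in
        x , lift (inj₁ (p , p′))

  CrN-rotated : ∀ {m} (xs : Fin m → L) (Wrapped : Fin m → Set) →
    (∀ {p q} → p F.< q → Wrapped p → Wrapped q) →
    (∀ {p q} → p F.< q → (Wrapped p × Wrapped q) ⊎ (¬ Wrapped p × ¬ Wrapped q) → xs p < xs q) →
    (∀ {p q} → p F.< q → ¬ Wrapped p → Wrapped q → xs q < xs p) →
    GL.CrN xs
  CrN-rotated xs Wrapped up same across = cr , distinct
    where
    cr : ∀ p q r → p F.< q → q F.< r → Cr (xs p) (xs q) (xs r)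
    cr p q r pq qr with decide (Wrapped p) | decide (Wrapped q) | decide (Wrapped r)
    ... | yes wp | yes wq | yes wr = inj₁ (same pq (inj₁ (wp , wq)) , same qr (inj₁ (wq , wr)))
    ... | no wp  | no wq  | no wr  = inj₁ (same pq (inj₂ (wp , wq)) , same qr (inj₂ (wq , wr)))
    ... | no wp  | no wq  | yes wr = inj₂ (inj₂ (across (FP.<-trans pq qr) wp wr , same pq (inj₂ (wp , wq))))
    ... | no wp  | yes wq | yes wr = inj₂ (inj₁ (same qr (inj₁ (wq , wr)) , across (FP.<-trans pq qr) wp wr))
    ... | yes wp | no wq  | _      = ⊥-elim (wq (up pq wp))
    ... | _      | yes wq | no wr  = ⊥-elim (wr (up qr wq))
    distinct : ∀ p q → p F.< q → xs p ≢ xs q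
    distinct p q pq with decide (Wrapped p) | decide (Wrapped q)
    ... | yes wp | yes wq = <⇒≢ (same pq (inj₁ (wp , wq)))
    ... | no wp  | no wq  = <⇒≢ (same pq (inj₂ (wp , wq)))
    ... | no wp  | yes wq = λ e → <⇒≢ (across pq wp wq) (sym e)
    ... | yes wp | no wq  = ⊥-elim (wq (up pq wp))

  module Sources {m} (b : Fin (suc m) → N̄) (b-mono : ∀ {i j} → i F.< j → b i <ᶜ b j) where
    open Gaps lem 𝕃 k b b-mono public

    -- sources listed in the order of their indices, except that the Wrapped ones lie below the others
    record Layout : Set₁ where
      field
        gap        : ℕ → Gap
        key        : Fin n × Fin 3 → Key
        key-proper : ∀ p → Placement.ProperKey gap (key p)
        Wrapped    : Fin n × Fin 3 → Set
        Wrapped-up : ∀ {p q} → p <ₗₑₓ q → Wrapped p → Wrapped q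
        key-mono   : ∀ {p q} → p <ₗₑₓ q → (Wrapped p × Wrapped q) ⊎ (¬ Wrapped p × ¬ Wrapped q) →
                     key p <ᵏ key q
        key-wrap   : ∀ {p q} → p <ₗₑₓ q → ¬ Wrapped p → Wrapped q → key q <ᵏ key p
        around     : ∀ i {x y} → Placement.InKey gap (key (i , 0F)) x → Placement.InKey gap (key (i , 1F)) y →
                     Crᶜ (↓ x) (b i) (↓ y)
      open Placement gap public

      source : Fin n × Fin 3 → GL.Interval circ
      source p = let open Gap (gap (proj₁ (key p))) ; t = proj₂ (key p) in
        lift (GL.arc (lo t) (hi t) (<⇒≢ (lo<hi t)))

      InSource⇒InKey : ∀ p {x} → ⟦ source p ⟧ᴸ x → InKey (key p) x
      InSource⇒InKey p h = Cr⇒between (Gap.lo<hi (gap (proj₁ (key p))) (proj₂ (key p))) (lower h)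

      I : Fin (n ℕ.* 3) → GL.Interval circ
      I q = source (F.remQuot 3 q)

      I-ordered : GL.OrderedSets circ (λ q → ⟦ I q ⟧ᴸ)
      I-ordered = nonempty , λ xs h →
        let inKey : ∀ q → InKey (key (F.remQuot 3 q)) (xs q)
            inKey q = InSource⇒InKey (F.remQuot 3 q) (h q)
            proper : ∀ q → ProperKey (key (F.remQuot 3 q))
            proper q = key-proper (F.remQuot 3 q)
        in CrN-rotated xs (λ q → Wrapped (F.remQuot 3 q))
             (λ pq → Wrapped-up (remQuot-<ₗₑₓ 3 pq))
             (λ {p} {q} pq c → InKey-< (key-mono (remQuot-<ₗₑₓ 3 pq) c) (proper p) (proper q) (inKey p) (inKey q))
             (λ {p} {q} pq ¬wp wq → InKey-< (key-wrap (remQuot-<ₗₑₓ 3 pq) ¬wp wq) (proper q) (proper p)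
                                            (inKey q) (inKey p))
        where
        nonempty : ∀ q → ∃ λ x → ⟦ I q ⟧ᴸ x
        nonempty q = let p = F.remQuot 3 q ; (x , l<x , x<h) = dense (Gap.lo<hi (gap (proj₁ (key p))) (proj₂ (key p))) in
          x , lift (inj₁ (l<x , x<h))

    Cr-around : ∀ gap i {x y} → let open Placement gap in
                ProperKey (sourceKey (i , 0F)) → ProperKey (sourceKey (i , 1F)) →
                InKey (sourceKey (i , 0F)) x → InKey (sourceKey (i , 1F)) y → Crᶜ (↓ x) (b i) (↓ y)
    Cr-around gap i px py hx hy =
      let open Placement gap
          (w , w<y , w∉bᵢ) = InKey⇒∉-below {sourceKey (i , 1F)} py hy i (ℕP.n<1+n _)
      in inj₁ (∈⇒↓<ᶜ (b i) (InKey-source⇒∈ px hx) , ∉⇒<ᶜ↓ (b i) w<y w∉bᵢ)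

    -- b 0F is the empty cut: the wrap-around gap is above b (F.fromℕ m) and holds the source below b 0F
    module WrapAbove (noMax : ¬ HasMax 𝕃) where
      highest : Gap
      highest = let (w , nw) = cut-notAll (b (F.fromℕ m)) ; (_ , wy) = ¬HasMax⇒above noMax w in top nw wy

      gap : ℕ → Gap
      gap = gaps highest highest

      open Placement gap

      key : Fin n × Fin 3 → Key
      key (i       , F.suc t) = sourceKey (i , F.suc t)
      key (0F      , 0F)      = n , 2F
      key (F.suc j , 0F)      = sourceKey (F.suc j , 0F)

      Wrapped : Fin n × Fin 3 → Set
      Wrapped (_       , F.suc _) = ⊤₀
      Wrapped (0F      , 0F)      = ⊥
      Wrapped (F.suc _ , 0F)      = ⊤₀

      key-wrapped : ∀ {p} → Wrapped p → key p ≡ sourceKey p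
      key-wrapped {F.suc _ , 0F}      _ = refl
      key-wrapped {_       , F.suc _} _ = refl

      key-proper : ∀ p → ProperKey (key p)
      key-proper (0F      , 0F)      = height-gaps highest highest ℕP.≤-refl refl , ℕP.≤-refl
      key-proper (F.suc j , 0F)      = height-gaps highest highest (ℕP.<⇒≤ (FP.toℕ<n (F.suc j))) refl ,
                                       ℕP.<⇒≤ (FP.toℕ<n (F.suc j))
      key-proper (i       , F.suc _) = height-gaps highest highest (FP.toℕ<n i) refl , FP.toℕ<n i

      Wrapped-up : ∀ {p q} → p <ₗₑₓ q → Wrapped p → Wrapped q
      Wrapped-up {q = F.suc _ , 0F}      _ _ = tt
      Wrapped-up {q = _       , F.suc _} _ _ = tt
      Wrapped-up {q = 0F      , 0F}      (inj₁ ())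
      Wrapped-up {q = 0F      , 0F}      (inj₂ (_ , ()))

      key-wrap : ∀ {p q} → p <ₗₑₓ q → ¬ Wrapped p → Wrapped q → key q <ᵏ key p
      key-wrap {0F , 0F} {F.suc j , 0F} _ _ _ = inj₁ (FP.toℕ<n (F.suc j))
      key-wrap {0F , 0F} {j , 1F}       _ _ _ = ≤-<ᵏ (FP.toℕ<n j) (s≤s z≤n)
      key-wrap {0F , 0F} {j , 2F}       _ _ _ = ≤-<ᵏ (FP.toℕ<n j) (s≤s (s≤s z≤n))
      key-wrap {F.suc _ , 0F}      _ ¬wp _ = ⊥-elim (¬wp tt)
      key-wrap {_       , F.suc _} _ ¬wp _ = ⊥-elim (¬wp tt)

      key-mono : ∀ {p q} → p <ₗₑₓ q → (Wrapped p × Wrapped q) ⊎ (¬ Wrapped p × ¬ Wrapped q) → key p <ᵏ key q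
      key-mono lt (inj₁ (wp , wq)) = subst₂ _<ᵏ_ (sym (key-wrapped wp)) (sym (key-wrapped wq)) (sourceKey-mono lt)
      key-mono {0F , 0F} {0F , 0F} (inj₁ ())
      key-mono {0F , 0F} {0F , 0F} (inj₂ (_ , ()))
      key-mono {0F , 0F} {F.suc _ , 0F}      _ (inj₂ (_ , ¬wq)) = ⊥-elim (¬wq tt)
      key-mono {0F , 0F} {_       , F.suc _} _ (inj₂ (_ , ¬wq)) = ⊥-elim (¬wq tt)
      key-mono {F.suc _ , 0F}      _ (inj₂ (¬wp , _)) = ⊥-elim (¬wp tt)
      key-mono {_       , F.suc _} _ (inj₂ (¬wp , _)) = ⊥-elim (¬wp tt)

      around : ∀ i {x y} → InKey (key (i , 0F)) x → InKey (key (i , 1F)) y → Crᶜ (↓ x) (b i) (↓ y)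
      around 0F hx hy =
        let (w , w<y , w∉b₀) = InKey⇒∉-below {key (0F , 1F)} (key-proper (0F , 1F)) hy 0F (s≤s z≤n)
            y<x = InKey-< {key (0F , 1F)} {key (0F , 0F)} (key-wrap (inj₂ (refl , s≤s z≤n)) (λ ()) tt)
                          (key-proper (0F , 1F)) (key-proper (0F , 0F)) hy hx
        in inj₂ (inj₁ (∉⇒<ᶜ↓ (b 0F) w<y w∉b₀ , ↓-mono y<x))
      around (F.suc j) = Cr-around gap (F.suc j) (key-proper (F.suc j , 0F)) (key-proper (F.suc j , 1F))

      layout : Layout
      layout = record
        { gap = gap ; key = key ; key-proper = key-proper ; Wrapped = Wrapped ; Wrapped-up = Wrapped-up
        ; key-mono = key-mono ; key-wrap = key-wrap ; around = around }

    -- b 0F is not empty: the wrap-around gap is below b 0F and holds the sources above b (F.fromℕ m)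
    module WrapBelow (w₀ : L) (w₀∈b₀ : pred (b 0F) w₀) where
      lowest : Gap
      lowest = bottom w₀ w₀∈b₀

      gap : ℕ → Gap
      gap = gaps lowest lowest

      open Placement gap

      Wrapped : Fin n × Fin 3 → Set
      Wrapped (i , 0F)      = ⊥
      Wrapped (i , F.suc _) = ¬ (suc (toℕ i) ℕ.< n)

      key : Fin n × Fin 3 → Key
      key (i , 0F)      = sourceKey (i , 0F)
      key (i , F.suc t) with suc (toℕ i) ℕP.<? n
      ... | yes _ = sourceKey (i , F.suc t)
      ... | no _  = 0 , sourceStep (F.suc t)

      key-unwrapped : ∀ {p} → ¬ Wrapped p → key p ≡ sourceKey p
      key-unwrapped {i , 0F}      _ = refl
      key-unwrapped {i , F.suc t} ¬w with suc (toℕ i) ℕP.<? n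
      ... | yes _  = refl
      ... | no ¬lt = ⊥-elim (¬w ¬lt)

      key-wrapped : ∀ {p} → Wrapped p → key p ≡ (0 , sourceStep (proj₂ p))
      key-wrapped {i , F.suc t} w with suc (toℕ i) ℕP.<? n
      ... | yes lt = ⊥-elim (w lt)
      ... | no _   = refl

      key-proper : ∀ p → ProperKey (key p)
      key-proper (i , 0F) with toℕ i in eq
      ... | zero  = refl , z≤n
      ... | suc h = height-gaps-inner lowest lowest (subst (ℕ._< n) eq (FP.toℕ<n i)) ,
                    subst (ℕ._≤ n) eq (ℕP.<⇒≤ (FP.toℕ<n i))
      key-proper (i , F.suc t) with suc (toℕ i) ℕP.<? n
      ... | yes lt = height-gaps-inner lowest lowest lt , ℕP.<⇒≤ lt
      ... | no _   = refl , z≤n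

      Wrapped-up : ∀ {p q} → p <ₗₑₓ q → Wrapped p → Wrapped q
      Wrapped-up {i , F.suc _} {j , _}       (inj₁ i<j)     w = ⊥-elim (w (ℕP.≤-<-trans i<j (FP.toℕ<n j)))
      Wrapped-up {i , F.suc _} {.i , F.suc _} (inj₂ (refl , _)) w = w

      key-mono : ∀ {p q} → p <ₗₑₓ q → (Wrapped p × Wrapped q) ⊎ (¬ Wrapped p × ¬ Wrapped q) → key p <ᵏ key q
      key-mono lt (inj₂ (¬wp , ¬wq)) =
        subst₂ _<ᵏ_ (sym (key-unwrapped ¬wp)) (sym (key-unwrapped ¬wq)) (sourceKey-mono lt)
      key-mono {i , F.suc _} {j , _} (inj₁ i<j) (inj₁ (wp , _)) = ⊥-elim (wp (ℕP.≤-<-trans i<j (FP.toℕ<n j)))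
      key-mono {i , 1F} {.i , 2F} (inj₂ (refl , _)) (inj₁ (wp , wq)) =
        subst₂ _<ᵏ_ (sym (key-wrapped {i , 1F} wp)) (sym (key-wrapped {i , 2F} wq)) (inj₂ (refl , s≤s z≤n))
      key-mono {i , 1F} {.i , 1F} (inj₂ (refl , s≤s ())) _
      key-mono {i , 2F} {.i , 1F} (inj₂ (refl , s≤s ())) _
      key-mono {i , 2F} {.i , 2F} (inj₂ (refl , s≤s (s≤s ()))) _

      key-wrap : ∀ {p q} → p <ₗₑₓ q → ¬ Wrapped p → Wrapped q → key q <ᵏ key p
      key-wrap {p} {q@(j , F.suc s)} _ ¬wp wq =
        subst₂ _<ᵏ_ (sym (key-wrapped {q} wq)) (sym (key-unwrapped ¬wp)) (wrapped<ᵏ p s ¬wp)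
        where
        wrapped<ᵏ : ∀ p (s : Fin 2) → ¬ Wrapped p → (0 , sourceStep (F.suc s)) <ᵏ sourceKey p
        wrapped<ᵏ (i , 0F)      0F ¬wp = ≤-<ᵏ z≤n (s≤s z≤n)
        wrapped<ᵏ (i , 0F)      1F ¬wp = ≤-<ᵏ z≤n (s≤s (s≤s z≤n))
        wrapped<ᵏ (i , F.suc _) _  ¬wp = inj₁ (s≤s z≤n)

      around : ∀ i {x y} → InKey (key (i , 0F)) x → InKey (key (i , 1F)) y → Crᶜ (↓ x) (b i) (↓ y)
      around i {x} {y} hx hy = by-cases (suc (toℕ i) ℕP.<? n)
        where
        by-cases : Dec (suc (toℕ i) ℕ.< n) → Crᶜ (↓ x) (b i) (↓ y)
        by-cases (yes lt) =
          let key≡ = key-unwrapped {i , 1F} (λ w → w lt) in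
          Cr-around gap i (key-proper (i , 0F)) (subst ProperKey key≡ (key-proper (i , 1F)))
                    hx (subst (λ κ → InKey κ y) key≡ hy)
        by-cases (no ¬lt) =
          let y<x = InKey-< {key (i , 1F)} {key (i , 0F)} (key-wrap (inj₂ (refl , s≤s z≤n)) (λ ()) ¬lt)
                            (key-proper (i , 1F)) (key-proper (i , 0F)) hy hx
          in inj₂ (inj₂ (↓-mono y<x , ∈⇒↓<ᶜ (b i) (InKey-source⇒∈ (key-proper (i , 0F)) hx)))

      layout : Layout
      layout = record
        { gap = gap ; key = key ; key-proper = key-proper ; Wrapped = Wrapped ; Wrapped-up = Wrapped-up
        ; key-mono = key-mono ; key-wrap = key-wrap ; around = around }

    layout : Layout
    layout with decide (∃ λ w → pred (b 0F) w)
    ... | yes (w , w∈b₀) = WrapBelow.layout w w∈b₀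
    ... | no b₀-empty with fromLower (IsCut.lowerCond (isCut (b 0F)))
    ...   | inj₁ w∈b₀ = ⊥-elim (b₀-empty w∈b₀)
    ...   | inj₂ noMax = WrapAbove.layout noMax

  IntervalTransitiveᶜ : Set
  IntervalTransitiveᶜ = ∀ m (I J : Fin m → GL.Interval circ) →
    GL.OrderedSets circ (λ i → ⟦ I i ⟧ᴸ) → GL.OrderedSets circ (λ i → ⟦ J i ⟧ᴸ) →
    ∃ λ g → G g × (∀ i → ∃ λ x → ⟦ I i ⟧ᴸ x × ⟦ J i ⟧ᴸ (Inverse.to g x))

  Approximates : ∀ {n} → (Fin n → N̄) → (Fin n → GC.Interval circ) → Set₁
  Approximates a J = ∃ λ g → G g × Σ (BarAut 𝕃 k) λ ḡ → Extends 𝕃 g ḡ × (∀ i → ⟦ J i ⟧ᶜ (fun ḡ (a i)))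

  ApproxOTransitiveᶜ : ℕ → Set₁
  ApproxOTransitiveᶜ n = ∀ (a : Fin n → N̄) (J : Fin n → GC.Interval circ) →
    GC.OrderedPoints circ a → GC.OrderedSets circ (λ i → ⟦ J i ⟧ᶜ) → Approximates a J

  least : ∀ m (a : Fin (suc m) → N̄) → ∃ λ s → ∀ i → ¬ a i <ᶜ a s
  least zero    a = 0F , λ { 0F → <ᶜ-irrefl {a 0F} }
  least (suc m) a with least m (λ i → a (F.suc i))
  ... | s , s-least with decide (a 0F <ᶜ a (F.suc s))
  ...   | no  a₀≮aₛ = F.suc s , λ { 0F → a₀≮aₛ ; (F.suc i) → s-least i }
  ...   | yes a₀<aₛ = 0F , λ { 0F → <ᶜ-irrefl {a 0F}
                             ; (F.suc i) aᵢ<a₀ →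
                                 s-least i (<ᶜ-trans {a (F.suc i)} {a 0F} {a (F.suc s)} aᵢ<a₀ a₀<aₛ) }

  Crᶜ-from-least : ∀ {l y z} → ¬ z <ᶜ l → Crᶜ l y z → y <ᶜ z
  Crᶜ-from-least z≮l (inj₁ (_ , y<z))        = y<z
  Crᶜ-from-least z≮l (inj₂ (inj₁ (_ , z<l))) = ⊥-elim (z≮l z<l)
  Crᶜ-from-least z≮l (inj₂ (inj₂ (z<l , _))) = ⊥-elim (z≮l z<l)

  <ᶜ-resp-≈ᶜ : ∀ {D D′ E E′} → D ≈ᶜ D′ → E ≈ᶜ E′ → D <ᶜ E → D′ <ᶜ E′
  <ᶜ-resp-≈ᶜ {D} {D′} {E} {E′} d e p = <ᶜ-respʳ-≈ᶜ {D′} {E} {E′} e (<ᶜ-respˡ-≈ᶜ {D} {D′} {E} d p)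

  Crᶜ-resp-≈ᶜ : ∀ {D D′ E E′ F F′} → D ≈ᶜ D′ → E ≈ᶜ E′ → F ≈ᶜ F′ → Crᶜ D E F → Crᶜ D′ E′ F′
  Crᶜ-resp-≈ᶜ {D} {D′} {E} {E′} {F} {F′} d e f (inj₁ (p , q)) =
    inj₁ (<ᶜ-resp-≈ᶜ {D} {D′} {E} {E′} d e p , <ᶜ-resp-≈ᶜ {E} {E′} {F} {F′} e f q)
  Crᶜ-resp-≈ᶜ {D} {D′} {E} {E′} {F} {F′} d e f (inj₂ (inj₁ (p , q))) =
    inj₂ (inj₁ (<ᶜ-resp-≈ᶜ {E} {E′} {F} {F′} e f p , <ᶜ-resp-≈ᶜ {F} {F′} {D} {D′} f d q))
  Crᶜ-resp-≈ᶜ {D} {D′} {E} {E′} {F} {F′} d e f (inj₂ (inj₂ (p , q))) =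
    inj₂ (inj₂ (<ᶜ-resp-≈ᶜ {F} {F′} {D} {D′} f d p , <ᶜ-resp-≈ᶜ {D} {D′} {E} {E′} d e q))

  Crᶜ-↓-between : ∀ {x y e} → x < y → Crᶜ (↓ x) e (↓ y) → (↓ x) <ᶜ e × e <ᶜ (↓ y)
  Crᶜ-↓-between x<y (inj₁ p)              = p
  Crᶜ-↓-between x<y (inj₂ (inj₁ (_ , q))) = ⊥-elim (<ᶜ-asym {↓ _} {↓ _} q (↓-mono x<y))
  Crᶜ-↓-between x<y (inj₂ (inj₂ (q , _))) = ⊥-elim (<ᶜ-asym {↓ _} {↓ _} q (↓-mono x<y))

  module Construction (hit : IntervalTransitiveᶜ) {m} (a : Fin (suc m) → N̄) (J : Fin (suc m) → GC.Interval circ)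
    (a-ordered : GC.OrderedPoints circ a) (J-ordered : GC.OrderedSets circ (λ i → ⟦ J i ⟧ᶜ)) where
    private module Cyc = Cycling _≈ᶜ_ _<ᶜ_ (λ {D} {E} → ≈ᶜ-sym {D} {E})

    -- reindexing so that the least point comes first makes the points increase
    s : Fin (suc m)
    s = proj₁ (least m a)

    π : Fin (suc m) → Fin (suc m)
    π = cycle^ (toℕ s)

    π-0 : π 0F ≡ s
    π-0 = FP.toℕ-injective (toℕ-cycle^ (toℕ s) 0F (ℕP.≤-pred (FP.toℕ<n s)))

    b : Fin (suc m) → N̄
    b r = a (π r)

    b₀-least : ∀ r → ¬ b r <ᶜ b 0F
    b₀-least r p = proj₂ (least m a) (π r) (subst (λ j → a (π r) <ᶜ a j) π-0 p)

    b-Cr : GC.CrN b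
    b-Cr = Cyc.CrN-cycle^ (toℕ s) a a-ordered

    b-mono : ∀ {r r′} → r F.< r′ → b r <ᶜ b r′
    b-mono {0F}      {r′} lt = ≉∧≯⇒<ᶜ {b 0F} {b r′} (proj₂ b-Cr 0F r′ lt) (b₀-least r′)
    b-mono {F.suc r} {r′} lt =
      Crᶜ-from-least {b 0F} {b (F.suc r)} {b r′} (b₀-least r′) (proj₁ b-Cr 0F (F.suc r) r′ (s≤s z≤n) lt)

    J′ : Fin (suc m) → GC.Interval circ
    J′ r = J (π r)

    open Targets J′ (Cyc.OrderedSets-cycle^ (toℕ s) (λ i → ⟦ J i ⟧ᶜ) J-ordered)
    open Sources b b-mono
    open Layout layout

    module _ (g : L ↔ L) (hits : ∀ q → ∃ λ x → ⟦ I q ⟧ᴸ x × ⟦ T q ⟧ᴸ (Inverse.to g x)) where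
      open Inverse g using (to)

      hit-at : ∀ p → ∃ λ x → ⟦ source p ⟧ᴸ x × ⟦ target p ⟧ᴸ (to x)
      hit-at (i , t) = subst (λ p → ∃ λ x → ⟦ source p ⟧ᴸ x × ⟦ target p ⟧ᴸ (to x))
                             (FP.remQuot-combine i t) (hits (F.combine i t))

      not-reversing : ¬ GL.RevCr to
      not-reversing rev =
        let xs = λ q → proj₁ (hits q)
            Cr-I = proj₁ (proj₂ I-ordered xs (λ q → proj₁ (proj₂ (hits q))))
                     0F 1F 2F (s≤s z≤n) (s≤s (s≤s z≤n))
            Cr-T = proj₁ (proj₂ T-ordered (λ q → to (xs q)) (λ q → proj₂ (proj₂ (hits q))))
                     0F 1F 2F (s≤s z≤n) (s≤s (s≤s z≤n))
        in Cyclic.Cr-asym _<_ <-asym Cr-T (proj₁ (rev _ _ _) Cr-I)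

      lands-in-J′ : (g-Cr : GL.PresCr to) → ∀ r → ⟦ J′ r ⟧ᶜ (fun (Completion.ḡ sense g g-Cr) (b r))
      lands-in-J′ g-Cr r =
        let open Completion sense g g-Cr using (ḡ; ḡ-extends; ḡ-PresCr)
            (x , hx , gx) = hit-at (r , 0F)
            (y , hy , gy) = hit-at (r , 1F)
            (x₀<gx , gx<x₁) = Cr⇒between (Window.lo<hi (W r) 0F) (lower gx)
            (x₁<gy , gy<x₂) = Cr⇒between (Window.lo<hi (W r) 1F) (lower gy)
            ḡ↓≈↓g : ∀ z → fun ḡ (↓ z) ≈ᶜ (↓ (to z))
            ḡ↓≈↓g z = represents⇒≈ᶜ↓ (fun ḡ (↓ z)) (to z) (ḡ-extends (↓ z) z (λ _ → (λ p → p) , (λ p → p)))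
            Cr-image = Crᶜ-resp-≈ᶜ {fun ḡ (↓ x)} {↓ (to x)} {fun ḡ (b r)} {fun ḡ (b r)} {fun ḡ (↓ y)} {↓ (to y)}
                         (ḡ↓≈↓g x) (≈ᶜ-refl {fun ḡ (b r)}) (ḡ↓≈↓g y)
                         (proj₁ (ḡ-PresCr (↓ x) (b r) (↓ y))
                                (around r (InSource⇒InKey (r , 0F) hx) (InSource⇒InKey (r , 1F) hy)))
            (↓gx<ḡb , ḡb<↓gy) = Crᶜ-↓-between {e = fun ḡ (b r)} (<-trans gx<x₁ x₁<gy) Cr-image
        in Window.captures (W r) (fun ḡ (b r))
             (↓<ᶜ<ᶜ↓⇒CutBetween {e = fun ḡ (b r)} x₀<gx (<-trans gy<x₂ (Window.x₂<x₃ (W r))) ↓gx<ḡb ḡb<↓gy)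

    approximates : Approximates a J
    approximates with hit (suc m ℕ.* 3) I T I-ordered T-ordered
    ... | g , g∈G , hits with preserves⊎reverses g (IsNearlyOrderedPermGroup.⊆Aut isG g g∈G)
    ...   | inj₂ rev  = ⊥-elim (not-reversing g hits rev)
    ...   | inj₁ g-Cr = g , g∈G , ḡ , ḡ-extends , λ i →
      let (r , πr≡i) = cycle^-surjective (toℕ s) i in
      subst (λ j → ⟦ J j ⟧ᶜ (fun ḡ (a j))) πr≡i (lands-in-J′ g hits g-Cr r)
      where open Completion sense g g-Cr using (ḡ; ḡ-extends)

  approxOTransitiveᶜ : IntervalTransitiveᶜ → ∀ n → ApproxOTransitiveᶜ n
  approxOTransitiveᶜ hit zero    _ _ _ _ =
    ↔-id L , IsNearlyOrderedPermGroup.has-id isG , ḡ , ḡ-extends , λ ()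
    where open Completion sense (↔-id L) (λ _ _ _ → (λ c → c) , (λ c → c)) using (ḡ; ḡ-extends)
  approxOTransitiveᶜ hit (suc m) a J a-ordered J-ordered = Construction.approximates hit a J a-ordered J-ordered

proposition12p1 : (lem : ∀ {ℓ : Level} → ExcludedMiddle ℓ)
    (𝕃 : DenseLinearOrder) (k : Kind) →
    EndpointCondition 𝕃 k →
    (G : DenseLinearOrder.Carrier 𝕃 ↔ DenseLinearOrder.Carrier 𝕃 → Set) →
    IsNearlyOrderedPermGroup 𝕃 k G →
    HighlyIntervalTransitive 𝕃 k G →
    HighlyApproxOTransitiveBar 𝕃 k G
proposition12p1 lem 𝕃 linear (noMin , noMax) G isG hit =
  LinearCase.approxOTransitiveˡ lem 𝕃 linear id id noMin noMax (λ _ pres → pres) G isG (λ _ pres → inj₁ pres) hit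
proposition12p1 lem 𝕃 monotonic (noMin , noMax) G isG hit =
  LinearCase.approxOTransitiveˡ lem 𝕃 monotonic id id noMin noMax (λ _ pres → inj₁ pres) G isG (λ _ sense → sense) hit
proposition12p1 lem 𝕃 circular endpoints G isG hit =
  CircularCase.approxOTransitiveᶜ lem 𝕃 circular id id endpoints (λ _ pres → pres) G isG (λ _ pres → inj₁ pres) hit
proposition12p1 lem 𝕃 monocircular endpoints G isG hit =
  CircularCase.approxOTransitiveᶜ lem 𝕃 monocircular id id endpoints (λ _ pres → inj₁ pres) G isG (λ _ sense → sense) hit
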